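{- Let $u<v$ be real quadratic irrationals with purely periodic continued fraction expansions. Then for every integer $k\ge1$, \[u<v\odot u^{\odot k},\qquad v^{\odot k}\odot u<v,\qquad u<u^{\odot k}\odot v,\qquad u\odot v^{\odot k}<v.\] If moreover $u,v$ are Markov irrationalities that are neighbors, then $u^{\mathrm{op}}<v^{\mathrm{op}}$, and the four inequalities above also hold with $u,v$ replaced by $u^{\mathrm{op}},v^{\mathrm{op}}$.
   Context: For purely periodic $u=[\overline{a_1;\ldots,a_r}]$, $v=[\overline{b_1;\ldots,b_s}]$ written with minimal even period lengths $r,s$, $u\odot v=[\overline{a_1;\ldots,a_r,b_1,\ldots,b_s}]$, $u^{\odot k}$ is the $k$-fold conjunction of $u$ with itself, and $u^{\mathrm{op}}=[\overline{a_r;\ldots,a_1}]$. Fractions $a/b<c/d$ in $[0,1/2]$ are neighbors if $bc-ad=1$; every rational in $(0,1/2)$ is the mediant $(a+c)/(b+d)$ of a unique pair of neighbors. Define $w:[0,1/2]\cap\mathbb{Q}\to\mathbb{R}$ by $w(0/1)=[\overline{1;1}]$, $w(1/2)=[\overline{2;2}]$, $w\big(\frac{a+c}{b+d}\big)=w(c/d)\odot w(a/b)$ for neighbors $a/b<c/d$; its values are the Markov irrationalities, and two Markov irrationalities are neighbors if their parameters are neighbors. -}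

module Defs where

open import Data.Nat as ℕ using (ℕ; zero; suc; _≤_)
open import Data.Nat.Divisibility using (_∣_)
open import Data.Integer as ℤ using (ℤ; +_)
open import Data.Rational as ℚ using (ℚ)
open import Data.List using (List; []; _∷_; _++_; length; concat; replicate; reverse)
open import Data.List.Relation.Unary.All using (All)
open import Data.Product using (_×_; Σ)
open import Data.Sum using (_⊎_)
open import Relation.Binary.PropositionalEquality using (_≡_)
open import Relation.Nullary using (¬_)

-- Periods of purely periodic continued fractions.
-- A list [a₁,…,a_r] stands for the real number [a₁; a₂, …, a_r, a₁, a₂, …]
-- (the overlined expansion).

ValidPeriod : List ℕ → Set
ValidPeriod p = (1 ≤ length p) × All (λ a → 1 ≤ a) p

_^ʷ_ : List ℕ → ℕ → List ℕ
w ^ʷ m = concat (replicate m w)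

IsMinEvenPeriod : List ℕ → Set
IsMinEvenPeriod p =
  ValidPeriod p × (2 ∣ length p) ×
  (∀ (w : List ℕ) (m : ℕ) → 2 ≤ m → 2 ∣ length w → ¬ (w ^ʷ m ≡ p))

-- With M = Π [[aᵢ,1],[1,0]] = [[P,P'],[Q,Q']], x = [overline a₁…a_r]
-- satisfies x = (P x + P')/(Q x + Q'), i.e. Q x² + (Q'-P) x - P' = 0,
-- and x is its positive root  x = (A + √D)/(2Q),
-- A = P - Q',  D = (P-Q')² + 4 Q P'.

record Mat : Set where
  constructor mat
  field m11 m12 m21 m22 : ℕ

_·_ : Mat → Mat → Mat
mat a b c d · mat e f g h =
  mat (a ℕ.* e ℕ.+ b ℕ.* g) (a ℕ.* f ℕ.+ b ℕ.* h)
      (c ℕ.* e ℕ.+ d ℕ.* g) (c ℕ.* f ℕ.+ d ℕ.* h)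

matOf : List ℕ → Mat
matOf []       = mat 1 0 0 1
matOf (a ∷ as) = mat a 1 1 0 · matOf as

-- a quadratic surd (A + √D) / (2Q)  (Q > 0, D ≥ 0)
record Surd : Set where
  constructor surd
  field
    A : ℤ
    D : ℤ
    Q : ℕ

val : List ℕ → Surd
val p = surd a (a ℤ.* a ℤ.+ + 4 ℤ.* + Q ℤ.* + P') Q
  where
  open Mat (matOf p) renaming (m11 to P; m12 to P'; m21 to Q; m22 to Q')
  a = + P ℤ.- + Q'

⟦_⟧ : ℤ → ℚ
⟦ z ⟧ = z ℚ./ 1

shift : Surd → ℚ → ℚ
shift (surd A D Q) t = ⟦ + (2 ℕ.* Q) ⟧ ℚ.* t ℚ.- ⟦ A ⟧

-- t < x  ⇔  2Qt − A < √D
_<ˢ_ : ℚ → Surd → Set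
t <ˢ x = (shift x t ℚ.< ℚ.0ℚ) ⊎ (shift x t ℚ.* shift x t ℚ.< ⟦ Surd.D x ⟧)

-- x < t  ⇔  √D < 2Qt − A
_ˢ<_ : Surd → ℚ → Set
x ˢ< t = (ℚ.0ℚ ℚ.< shift x t) × (⟦ Surd.D x ⟧ ℚ.< shift x t ℚ.* shift x t)

_<ᴿ_ : Surd → Surd → Set
x <ᴿ y = Σ ℚ λ t → (x ˢ< t) × (t <ˢ y)

_≈ᴿ_ : Surd → Surd → Set
x ≈ᴿ y = ¬ (x <ᴿ y) × ¬ (y <ᴿ x)

-- Markov irrationalities.
-- Neighbors a/b < c/d in [0,1/2]: b c − a d = 1 (all fractions with
-- positive denominators, inside [0,1/2]).

InHalf : ℕ → ℕ → Set
InHalf a b = (1 ≤ b) × (2 ℕ.* a ≤ b)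

Neighbors : ℕ → ℕ → ℕ → ℕ → Set
Neighbors a b c d = InHalf a b × InHalf c d × (b ℕ.* c ≡ a ℕ.* d ℕ.+ 1)

-- graph of w: MarkovWord a b x means w(a/b) = [overline x]
data MarkovWord : ℕ → ℕ → List ℕ → Set where
  w0   : MarkovWord 0 1 (1 ∷ 1 ∷ [])
  wh   : MarkovWord 1 2 (2 ∷ 2 ∷ [])
  wmed : ∀ {a b c d x y} → Neighbors a b c d →
         MarkovWord a b x → MarkovWord c d y →
         MarkovWord (a ℕ.+ c) (b ℕ.+ d) (y ++ x)

IsMarkovWithParam : List ℕ → ℕ → ℕ → Set
IsMarkovWithParam p a b = Σ (List ℕ) λ x → MarkovWord a b x × (val x ≈ᴿ val p)

FourIneqs : List ℕ → List ℕ → ℕ → Set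
FourIneqs p q k =
  (val p <ᴿ val (q ++ (p ^ʷ k))) ×
  (val ((q ^ʷ k) ++ p) <ᴿ val q) ×
  (val p <ᴿ val ((p ^ʷ k) ++ q)) ×
  (val (p ++ (q ^ʷ k)) <ᴿ val q)

{-# OPTIONS --safe #-}
-- For a word l = a₁ … a_r of positive integers, t ↦ [a₁; a₂, …, a_r, t] is increasing
-- when r is even, and [overline l] is its unique positive fixed point, so a positive
-- rational t lies above [overline l] exactly when the map moves t down.  Comparisons
-- of these surds are thus witnessed by rationals, and words compare, on tails ≥ 1, by
-- the alternating lexicographic order of continued fractions.  If
-- [overline p] < t < [overline q] then p q precedes q p in that order (p q = q p
-- would give p^|q| = q^|p|, hence equal values), and applying the maps of p and q to t
-- produces rationals separating each of the four pairs.  For neighboring Markov words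
-- x = w(a/b) and y = w(c/d), x y and y x agree except for a block 1 1 2 2 that becomes
-- 2 2 1 1 (induction along the Farey tree), and reversal preserves this shape; hence
-- [overline x] < [overline y] and the same for the reversed words.  A period with the
-- same value as a Markov word has a common power with it, which transfers these
-- comparisons to p and q.

module Submission where

open import Defs
open import Data.Nat using (ℕ; zero; suc; _+_; _*_; _∸_; _≤_; _<_; z≤n; s≤s; >-nonZero)
import Data.Nat.Properties as ℕₚ
open import Data.Nat.Tactic.RingSolver using (solve-∀)
open import Data.Nat.Divisibility using (_∣_; divides; ∣-refl; ∣1⇒≡1; ∣m+n∣m⇒∣n; ∣m⇒∣m*n; n∣m*n; >⇒∤)
open import Data.Nat.Coprimality as Coprimality using (Coprime; coprime-divisor)
open import Data.Integer as ℤ using (ℤ; +_; -[1+_]; +≤+; +<+; -≤+)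
import Data.Integer.Properties as ℤₚ
import Data.Integer.Tactic.RingSolver as ℤ-Solver
open import Data.Rational as ℚ using (ℚ; mkℚ; toℚᵘ; fromℚᵘ)
import Data.Rational.Properties as ℚₚ
open import Data.Rational.Unnormalised as ℚᵘ using (mkℚᵘ; *<*; *≡*) renaming (_≃_ to _≃ᵘ_)
import Data.Rational.Unnormalised.Properties as ℚᵘₚ
open import Data.List using (List; []; _∷_; _++_; length; foldr; reverse)
open import Data.List.Properties
  using (foldr-++; ++-assoc; ++-identityʳ; length-++; length-++-comm; length-reverse; reverse-++;
         ∷-injectiveˡ; ∷-injectiveʳ; ≡-dec)
open import Data.List.Relation.Unary.All using (All; []; _∷_)
import Data.List.Relation.Unary.All.Properties as Allₚ
open import Data.Product as Product using (_×_; _,_; proj₁; proj₂; Σ)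
open import Data.Sum as Sum using (_⊎_; inj₁; inj₂; [_,_])
open import Data.Empty using (⊥-elim)
open import Function using (_∘_; _⇔_; mk⇔; Equivalence)
open import Function.Properties.Equivalence using () renaming (trans to ⇔-trans)
open import Relation.Binary.Definitions using (Tri; tri<; tri≈; tri>)
open import Relation.Binary.PropositionalEquality hiding ([_])
open import Relation.Nullary using (¬_; yes; no)

open Equivalence using (to; from)

-- Continued fractions acting on fractions

-- A pair (x , y) stands for the fraction x / y.  step c is t ↦ c + 1/t, so
-- act [a₁, …, a_r] t = [a₁; a₂, …, a_r, t].
Frac : Set
Frac = ℕ × ℕ

record _≺_ (u v : Frac) : Set where
  constructor mk≺
  field un≺ : proj₁ u * proj₂ v < proj₁ v * proj₂ u

record _≼_ (u v : Frac) : Set where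
  constructor mk≼
  field un≼ : proj₁ u * proj₂ v ≤ proj₁ v * proj₂ u

Positive : Frac → Set
Positive (x , y) = 0 < x × 0 < y

AtLeastOne : Frac → Set
AtLeastOne (x , y) = 0 < y × y ≤ x

AtLeastOne⇒Positive : ∀ {t} → AtLeastOne t → Positive t
AtLeastOne⇒Positive (0<y , y≤x) = ℕₚ.<-≤-trans 0<y y≤x , 0<y

≺-AtLeastOne : ∀ {u v} → AtLeastOne u → u ≺ v → Positive v → AtLeastOne v
≺-AtLeastOne {x , y} {x′ , y′} (y>0 , y≤x) (mk≺ xy′<x′y) (_ , y′>0) =
  y′>0 , ℕₚ.<⇒≤ (ℕₚ.*-cancelʳ-< y y′ x′
    (ℕₚ.≤-<-trans (subst (_≤ x * y′) (ℕₚ.*-comm y y′) (ℕₚ.*-monoˡ-≤ y′ y≤x)) xy′<x′y))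

≺⇒≼ : ∀ {u v} → u ≺ v → u ≼ v
≺⇒≼ (mk≺ h) = mk≼ (ℕₚ.<⇒≤ h)

≼-refl : ∀ {u} → u ≼ u
≼-refl = mk≼ ℕₚ.≤-refl

≺⇒⋡ : ∀ {u v} → u ≺ v → ¬ v ≼ u
≺⇒⋡ (mk≺ h) (mk≼ h′) = ℕₚ.<⇒≱ h h′

≺-or-≽ : ∀ u v → u ≺ v ⊎ v ≼ u
≺-or-≽ (a , b) (c , d) with a * d ℕₚ.<? c * b
... | yes h = inj₁ (mk≺ h)
... | no h  = inj₂ (mk≼ (ℕₚ.≮⇒≥ h))

private
  *-swapʳ : ∀ m n o → m * n * o ≡ m * o * n
  *-swapʳ = solve-∀

≺-trans : ∀ {u v w} → Positive u → u ≺ v → v ≺ w → u ≺ w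
≺-trans {a , b} {c , d} {e , f} (_ , b>0) (mk≺ ad<cb) (mk≺ cf<ed) =
  mk≺ (ℕₚ.*-cancelʳ-< d (a * f) (e * b) (begin-strict
    a * f * d  ≡⟨ *-swapʳ a f d ⟩
    a * d * f  ≤⟨ ℕₚ.*-monoˡ-≤ f (ℕₚ.<⇒≤ ad<cb) ⟩
    c * b * f  ≡⟨ *-swapʳ c b f ⟩
    c * f * b  <⟨ ℕₚ.*-monoˡ-< b {{>-nonZero b>0}} cf<ed ⟩
    e * d * b  ≡⟨ *-swapʳ e d b ⟩
    e * b * d  ∎))
  where open ℕₚ.≤-Reasoning

≼-trans : ∀ {u v w} → Positive v → u ≼ v → v ≼ w → u ≼ w
≼-trans {a , b} {c , d} {e , f} (_ , d>0) (mk≼ ad≤cb) (mk≼ cf≤ed) =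
  mk≼ (ℕₚ.*-cancelʳ-≤ (a * f) (e * b) d {{>-nonZero d>0}} (begin
    a * f * d  ≡⟨ *-swapʳ a f d ⟩
    a * d * f  ≤⟨ ℕₚ.*-monoˡ-≤ f ad≤cb ⟩
    c * b * f  ≡⟨ *-swapʳ c b f ⟩
    c * f * b  ≤⟨ ℕₚ.*-monoˡ-≤ b cf≤ed ⟩
    e * d * b  ≡⟨ *-swapʳ e d b ⟩
    e * b * d  ∎))
  where open ℕₚ.≤-Reasoning

step : ℕ → Frac → Frac
step c (x , y) = (c * x + y , x)

act : List ℕ → Frac → Frac
act l t = foldr step t l

act-++ : ∀ a b t → act (a ++ b) t ≡ act a (act b t)
act-++ a b t = foldr-++ step t a b

private
  step-cross : ∀ c x x′ y → c * x * x′ + x′ * y ≡ (c * x + y) * x′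
  step-cross = solve-∀

  step-cross′ : ∀ c x x′ y′ → c * x * x′ + x * y′ ≡ (c * x′ + y′) * x
  step-cross′ = solve-∀

step-antimono-≺ : ∀ c {x y x′ y′} → (x , y) ≺ (x′ , y′) → step c (x′ , y′) ≺ step c (x , y)
step-antimono-≺ c {x} {y} {x′} {y′} (mk≺ h) =
  mk≺ (subst₂ _<_ (step-cross′ c x x′ y′) (step-cross c x x′ y) (ℕₚ.+-monoʳ-< (c * x * x′) h))

step-antimono-≼ : ∀ c {x y x′ y′} → (x , y) ≼ (x′ , y′) → step c (x′ , y′) ≼ step c (x , y)
step-antimono-≼ c {x} {y} {x′} {y′} (mk≼ h) =
  mk≼ (subst₂ _≤_ (step-cross′ c x x′ y′) (step-cross c x x′ y) (ℕₚ.+-monoʳ-≤ (c * x * x′) h))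

data EvenLength : List ℕ → Set where
  []    : EvenLength []
  cons₂ : ∀ {a b l} → EvenLength l → EvenLength (a ∷ b ∷ l)

act-mono-≺ : ∀ {l u v} → EvenLength l → u ≺ v → act l u ≺ act l v
act-mono-≺ []                h = h
act-mono-≺ (cons₂ {a} {b} e) h = step-antimono-≺ a (step-antimono-≺ b (act-mono-≺ e h))

act-mono-≼ : ∀ {l u v} → EvenLength l → u ≼ v → act l u ≼ act l v
act-mono-≼ []                h = h
act-mono-≼ (cons₂ {a} {b} e) h = step-antimono-≼ a (step-antimono-≼ b (act-mono-≼ e h))

AllPositive : List ℕ → Set
AllPositive = All (1 ≤_)

step-positive : ∀ {c t} → 1 ≤ c → Positive t → Positive (step c t)
step-positive {c} 1≤c (x>0 , _) = ℕₚ.≤-trans (ℕₚ.*-mono-≤ 1≤c x>0) (ℕₚ.m≤m+n (c * _) _) , x>0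

act-positive : ∀ {l t} → AllPositive l → Positive t → Positive (act l t)
act-positive []           pt = pt
act-positive (1≤c ∷ pl) pt = step-positive 1≤c (act-positive pl pt)

step-atLeastOne : ∀ {c t} → 1 ≤ c → Positive t → AtLeastOne (step c t)
step-atLeastOne {c} {x , y} 1≤c (x>0 , _) =
  x>0 , ℕₚ.≤-trans (ℕₚ.m≤n*m x c {{>-nonZero 1≤c}}) (ℕₚ.m≤m+n (c * x) y)

act-atLeastOne : ∀ {l t} → AllPositive l → AtLeastOne t → AtLeastOne (act l t)
act-atLeastOne []           g = g
act-atLeastOne (1≤c ∷ pl) g = step-atLeastOne 1≤c (AtLeastOne⇒Positive (act-atLeastOne pl g))

act-∷-atLeastOne : ∀ {c l t} → AllPositive (c ∷ l) → Positive t → AtLeastOne (act (c ∷ l) t)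
act-∷-atLeastOne (1≤c ∷ pl) pt = step-atLeastOne 1≤c (act-positive pl pt)

-- The alternating lexicographic order

-- a ⊏ b says [a; X] < [b; Y] for all tails X, Y ≥ 1: the order of continued
-- fractions, lexicographic with alternating signs.
_⊏_ : List ℕ → List ℕ → Set
a ⊏ b = ∀ X Y → AtLeastOne X → AtLeastOne Y → act a X ≺ act b Y

private
  step-bound : ∀ c x₁ x₂ → (c * x₁ + x₁) * x₂ ≡ (1 + c) * x₁ * x₂
  step-bound = solve-∀

  step-expand : ∀ d x₁ x₂ y₂ → d * x₁ * x₂ + y₂ * x₁ ≡ (d * x₂ + y₂) * x₁
  step-expand = solve-∀

∷-⊏ : ∀ {c d a b} → c < d → AllPositive a → AllPositive b → (c ∷ a) ⊏ (d ∷ b)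
∷-⊏ {c} {d} c<d pa pb X Y gX gY = cross (act-atLeastOne pa gX) (act-atLeastOne pb gY)
  where
  open ℕₚ.≤-Reasoning
  cross : ∀ {u w} → AtLeastOne u → AtLeastOne w → step c u ≺ step d w
  cross {x₁ , y₁} {x₂ , y₂} (y₁>0 , y₁≤x₁) (y₂>0 , _) = mk≺ (begin-strict
    (c * x₁ + y₁) * x₂     ≤⟨ ℕₚ.*-monoˡ-≤ x₂ (ℕₚ.+-monoʳ-≤ (c * x₁) y₁≤x₁) ⟩
    (c * x₁ + x₁) * x₂     ≡⟨ step-bound c x₁ x₂ ⟩
    suc c * x₁ * x₂        ≤⟨ ℕₚ.*-monoˡ-≤ x₂ (ℕₚ.*-monoˡ-≤ x₁ c<d) ⟩
    d * x₁ * x₂            <⟨ ℕₚ.m<m+n (d * x₁ * x₂) (ℕₚ.*-mono-< y₂>0 (ℕₚ.<-≤-trans y₁>0 y₁≤x₁)) ⟩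
    d * x₁ * x₂ + y₂ * x₁  ≡⟨ step-expand d x₁ x₂ y₂ ⟩
    (d * x₂ + y₂) * x₁     ∎)

∷-⊏-flip : ∀ c {a b} → a ⊏ b → (c ∷ b) ⊏ (c ∷ a)
∷-⊏-flip c a⊏b X Y gX gY = step-antimono-≺ c (a⊏b Y X gY gX)

first-difference : ∀ a b → length a ≡ length b → AllPositive a → AllPositive b →
                   a ≢ b → a ⊏ b ⊎ b ⊏ a
first-difference []      []      _ _ _ a≢b = ⊥-elim (a≢b refl)
first-difference (c ∷ a) (d ∷ b) |a|≡|b| (_ ∷ pa) (_ ∷ pb) a≢b with ℕₚ.<-cmp c d
... | tri< c<d _ _  = inj₁ (∷-⊏ c<d pa pb)
... | tri> _ _ d<c  = inj₂ (∷-⊏ d<c pb pa)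
... | tri≈ _ refl _ =
  Sum.swap (Sum.map (∷-⊏-flip c {a} {b}) (∷-⊏-flip c {b} {a})
    (first-difference a b (ℕₚ.suc-injective |a|≡|b|) pa pb (a≢b ∘ cong (c ∷_))))

⊏-prefix : ∀ {s a b} → EvenLength s → a ⊏ b → (s ++ a) ⊏ (s ++ b)
⊏-prefix {s} {a} {b} es a⊏b X Y gX gY =
  subst₂ _≺_ (sym (act-++ s a X)) (sym (act-++ s b Y)) (act-mono-≺ es (a⊏b X Y gX gY))

-- Position relative to the fixed point

-- For positive t, Above l t says that t lies above the fixed point [overline l]
-- of t ↦ act l t, and Below l t that it lies below it.
Above Below : List ℕ → Frac → Set
Above l t = act l t ≺ t
Below l t = t ≺ act l t

Above⇒AtLeastOne : ∀ {w t} → AllPositive w → 1 ≤ length w → Positive t → Above w t → AtLeastOne t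
Above⇒AtLeastOne {_ ∷ _} aw _ pt above = ≺-AtLeastOne (act-∷-atLeastOne aw pt) above pt

num den : Mat → ℕ → ℕ → ℕ
num M x y = Mat.m11 M * x + Mat.m12 M * y
den M x y = Mat.m21 M * x + Mat.m22 M * y

private
  num-identity : ∀ x y → x ≡ 1 * x + 0 * y
  num-identity = solve-∀

  den-identity : ∀ x y → y ≡ 0 * x + 1 * y
  den-identity = solve-∀

  num-step : ∀ a P P′ Q Q′ x y →
             a * (P * x + P′ * y) + (Q * x + Q′ * y) ≡ (a * P + 1 * Q) * x + (a * P′ + 1 * Q′) * y
  num-step = solve-∀

  den-step : ∀ P P′ Q Q′ x y → P * x + P′ * y ≡ (1 * P + 0 * Q) * x + (1 * P′ + 0 * Q′) * y
  den-step = solve-∀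

act-matOf : ∀ l x y → act l (x , y) ≡ (num (matOf l) x y , den (matOf l) x y)
act-matOf []      x y = cong₂ _,_ (num-identity x y) (den-identity x y)
act-matOf (a ∷ l) x y = trans (cong (step a) (act-matOf l x y))
  (cong₂ _,_ (num-step a P P′ Q Q′ x y) (den-step P P′ Q Q′ x y))
  where open Mat (matOf l) renaming (m11 to P; m12 to P′; m21 to Q; m22 to Q′)

-- t lies above (below) the positive fixed point of x / y ↦ num M x y / den M x y.
AboveFix BelowFix : Mat → Frac → Set
AboveFix M (x , y) = num M x y * y < x * den M x y
BelowFix M (x , y) = x * den M x y < num M x y * y

Above⇔AboveFix : ∀ l t → Above l t ⇔ AboveFix (matOf l) t
Above⇔AboveFix l (x , y) =
  subst (λ s → (s ≺ (x , y)) ⇔ AboveFix (matOf l) (x , y)) (sym (act-matOf l x y)) (mk⇔ _≺_.un≺ mk≺)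

Below⇔BelowFix : ∀ l t → Below l t ⇔ BelowFix (matOf l) t
Below⇔BelowFix l (x , y) =
  subst (λ s → ((x , y) ≺ s) ⇔ BelowFix (matOf l) (x , y)) (sym (act-matOf l x y)) (mk⇔ _≺_.un≺ mk≺)

private
  num-scale : ∀ P P′ x y k → (P * (x * k) + P′ * (y * k)) * (y * k) ≡ (P * x + P′ * y) * y * (k * k)
  num-scale = solve-∀

  den-scale : ∀ Q Q′ x y k → x * k * (Q * (x * k) + Q′ * (y * k)) ≡ x * (Q * x + Q′ * y) * (k * k)
  den-scale = solve-∀

  *-square-mono-< : ∀ {a b} k → 0 < k → a < b ⇔ a * (k * k) < b * (k * k)
  *-square-mono-< {a} {b} k k>0 =
    mk⇔ (ℕₚ.*-monoˡ-< (k * k) {{>-nonZero (ℕₚ.*-mono-< k>0 k>0)}}) (ℕₚ.*-cancelʳ-< (k * k) a b)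

AboveFix-scale : ∀ M {x y} k → 0 < k → AboveFix M (x , y) ⇔ AboveFix M (x * k , y * k)
AboveFix-scale (mat P P′ Q Q′) {x} {y} k k>0 =
  subst₂ (λ l r → AboveFix (mat P P′ Q Q′) (x , y) ⇔ l < r)
    (sym (num-scale P P′ x y k)) (sym (den-scale Q Q′ x y k)) (*-square-mono-< k k>0)

BelowFix-scale : ∀ M {x y} k → 0 < k → BelowFix M (x , y) ⇔ BelowFix M (x * k , y * k)
BelowFix-scale (mat P P′ Q Q′) {x} {y} k k>0 =
  subst₂ (λ l r → BelowFix (mat P P′ Q Q′) (x , y) ⇔ l < r)
    (sym (den-scale Q Q′ x y k)) (sym (num-scale P P′ x y k)) (*-square-mono-< k k>0)

private
  gap-left : ∀ P P′ Q Q′ X δ Y →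
    (P * (X + δ) + P′ * Y) * Y + X * (Q * X + Q′ * Y) ≡
    (P * X + P′ * Y) * Y + X * (Q * X + Q′ * Y) + δ * (P * Y)
  gap-left = solve-∀

  gap-right : ∀ P P′ Q Q′ X δ Y →
    (P * X + P′ * Y) * Y + X * (Q * X + Q′ * Y) + δ * (Q * X + Q′ * Y + (Q * X + Q * δ)) ≡
    (X + δ) * (Q * (X + δ) + Q′ * Y) + (P * X + P′ * Y) * Y
  gap-right = solve-∀

  num-split : ∀ P P′ X Y → (P * X + P′ * Y) * Y ≡ X * (P * Y) + P′ * Y * Y
  num-split = solve-∀

-- x (Q x + Q′ y) − (P x + P′ y) y increases by δ (2 Q x + Q δ + Q′ y − P y) from x to
-- x + δ, which is nonnegative once P y ≤ Q x + Q′ y.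
gap-grows : ∀ P P′ Q Q′ X δ Y → P * Y ≤ Q * X + Q′ * Y →
  (P * (X + δ) + P′ * Y) * Y + X * (Q * X + Q′ * Y) ≤
  (X + δ) * (Q * (X + δ) + Q′ * Y) + (P * X + P′ * Y) * Y
gap-grows P P′ Q Q′ X δ Y PY≤den = begin
  (P * (X + δ) + P′ * Y) * Y + X * (Q * X + Q′ * Y)
    ≡⟨ gap-left P P′ Q Q′ X δ Y ⟩
  (P * X + P′ * Y) * Y + X * (Q * X + Q′ * Y) + δ * (P * Y)
    ≤⟨ ℕₚ.+-monoʳ-≤ _ (ℕₚ.*-monoʳ-≤ δ (ℕₚ.≤-trans PY≤den (ℕₚ.m≤m+n _ _))) ⟩
  (P * X + P′ * Y) * Y + X * (Q * X + Q′ * Y) + δ * (Q * X + Q′ * Y + (Q * X + Q * δ))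
    ≡⟨ gap-right P P′ Q Q′ X δ Y ⟩
  (X + δ) * (Q * (X + δ) + Q′ * Y) + (P * X + P′ * Y) * Y ∎
  where open ℕₚ.≤-Reasoning

num-lower : ∀ M X Y → X * (Mat.m11 M * Y) ≤ num M X Y * Y
num-lower (mat P P′ _ _) X Y = subst (X * (P * Y) ≤_) (sym (num-split P P′ X Y)) (ℕₚ.m≤m+n _ _)

AboveFix⇒slope : ∀ M {X Y} → AboveFix M (X , Y) → Mat.m11 M * Y < den M X Y
AboveFix⇒slope M {X} {Y} above = ℕₚ.*-cancelˡ-< X _ _ (ℕₚ.≤-<-trans (num-lower M X Y) above)

AboveFix-shift : ∀ M {X Y} δ → AboveFix M (X , Y) → AboveFix M (X + δ , Y)
AboveFix-shift M@(mat P P′ Q Q′) {X} {Y} δ above =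
  ℕₚ.+-cancelʳ-< (X * (Q * X + Q′ * Y)) _ _
    (ℕₚ.≤-<-trans (gap-grows P P′ Q Q′ X δ Y (ℕₚ.<⇒≤ (AboveFix⇒slope M above))) (ℕₚ.+-monoʳ-< _ above))

BelowFix-unshift : ∀ M {X Y} δ → 1 ≤ Mat.m12 M → 0 < Y → BelowFix M (X + δ , Y) → BelowFix M (X , Y)
BelowFix-unshift (mat P P′ Q Q′) {X} {Y} δ 1≤P′ Y>0 below with Q * X + Q′ * Y ℕₚ.≤? P * Y
... | yes den≤PY = ℕₚ.≤-<-trans (ℕₚ.*-monoʳ-≤ X den≤PY)
  (subst (X * (P * Y) <_) (sym (num-split P P′ X Y))
    (ℕₚ.m<m+n _ (ℕₚ.*-mono-< (ℕₚ.*-mono-< 1≤P′ Y>0) Y>0)))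
... | no den≰PY = ℕₚ.+-cancelˡ-< ((P * (X + δ) + P′ * Y) * Y) _ _
  (ℕₚ.≤-<-trans (gap-grows P P′ Q Q′ X δ Y (ℕₚ.<⇒≤ (ℕₚ.≰⇒> den≰PY))) (ℕₚ.+-monoˡ-< _ below))

-- Compare t = x / y and t′ = x′ / y′ over the common denominator y y′.
AboveFix-upward : ∀ M {t t′} → Positive t → Positive t′ → t ≼ t′ → AboveFix M t → AboveFix M t′
AboveFix-upward M {x , y} {x′ , y′} (_ , y>0) (_ , y′>0) (mk≼ xy′≤x′y) above =
  from (AboveFix-scale M y y>0) (subst (λ d → AboveFix M (x′ * y , d)) (ℕₚ.*-comm y y′)
    (subst (λ n → AboveFix M (n , y * y′)) (ℕₚ.m+[n∸m]≡n xy′≤x′y)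
      (AboveFix-shift M (x′ * y ∸ x * y′)
        (to (AboveFix-scale M y′ y′>0) above))))

BelowFix-downward : ∀ M {t t′} → 1 ≤ Mat.m12 M → Positive t → Positive t′ → t ≼ t′ →
                    BelowFix M t′ → BelowFix M t
BelowFix-downward M {x , y} {x′ , y′} 1≤P′ (_ , y>0) (_ , y′>0) (mk≼ xy′≤x′y) below =
  from (BelowFix-scale M y′ y′>0)
    (BelowFix-unshift M (x′ * y ∸ x * y′) 1≤P′ (ℕₚ.*-mono-< y>0 y′>0)
      (subst (λ n → BelowFix M (n , y * y′)) (sym (ℕₚ.m+[n∸m]≡n xy′≤x′y))
        (subst (λ d → BelowFix M (x′ * y , d)) (ℕₚ.*-comm y′ y)
          (to (BelowFix-scale M y y>0) below))))

Above-upward : ∀ l {t t′} → Positive t → Positive t′ → t ≼ t′ → Above l t → Above l t′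
Above-upward l {t} {t′} pt pt′ t≼t′ =
  from (Above⇔AboveFix l t′) ∘ AboveFix-upward (matOf l) pt pt′ t≼t′ ∘ to (Above⇔AboveFix l t)

Below-downward : ∀ l {t t′} → 1 ≤ Mat.m12 (matOf l) → Positive t → Positive t′ → t ≼ t′ →
                 Below l t′ → Below l t
Below-downward l {t} {t′} 1≤P′ pt pt′ t≼t′ =
  from (Below⇔BelowFix l t) ∘ BelowFix-downward (matOf l) 1≤P′ pt pt′ t≼t′ ∘ to (Below⇔BelowFix l t′)

Below-≺-Above : ∀ w {r s} → Positive r → Positive s → Above w s → Below w r → r ≺ s
Below-≺-Above w {r} {s} pr ps above below with ≺-or-≽ r s
... | inj₁ r≺s = r≺s
... | inj₂ s≼r = ⊥-elim (≺⇒⋡ below (≺⇒≼ (Above-upward w ps pr s≼r above)))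

record MatBounds (M : Mat) : Set where
  field
    P′≤P  : Mat.m12 M ≤ Mat.m11 M
    Q′≤Q  : Mat.m22 M ≤ Mat.m21 M
    Q≤P   : Mat.m21 M ≤ Mat.m11 M
    Q′≤P′ : Mat.m22 M ≤ Mat.m12 M
    1≤Q   : 1 ≤ Mat.m21 M
    1≤P′  : 1 ≤ Mat.m12 M

private
  mat-cong : ∀ {a b c d a′ b′ c′ d′} → a ≡ a′ → b ≡ b′ → c ≡ c′ → d ≡ d′ →
             mat a b c d ≡ mat a′ b′ c′ d′
  mat-cong refl refl refl refl = refl

  step-entry : ∀ a P Q → a * P + 1 * Q ≡ a * P + Q
  step-entry = solve-∀

  shift-entry : ∀ P Q → 1 * P + 0 * Q ≡ P
  shift-entry = solve-∀

  single-entry : ∀ a → a * 1 + 1 * 0 ≡ a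
  single-entry = solve-∀

  single-entry′ : ∀ a → a * 0 + 1 * 1 ≡ 1
  single-entry′ = solve-∀

matOf-∷ : ∀ a l → matOf (a ∷ l) ≡
          mat (a * Mat.m11 (matOf l) + Mat.m21 (matOf l)) (a * Mat.m12 (matOf l) + Mat.m22 (matOf l))
              (Mat.m11 (matOf l)) (Mat.m12 (matOf l))
matOf-∷ a l = mat-cong (step-entry a P Q) (step-entry a P′ Q′) (shift-entry P Q) (shift-entry P′ Q′)
  where open Mat (matOf l) renaming (m11 to P; m12 to P′; m21 to Q; m22 to Q′)

matOf-bounds : ∀ {a l} → AllPositive (a ∷ l) → MatBounds (matOf (a ∷ l))
matOf-bounds {a} {[]} (1≤a ∷ []) =
  subst MatBounds (sym (mat-cong (single-entry a) (single-entry′ a) refl refl)) (record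
    { P′≤P = 1≤a ; Q′≤Q = z≤n ; Q≤P = 1≤a ; Q′≤P′ = z≤n ; 1≤Q = ℕₚ.≤-refl ; 1≤P′ = ℕₚ.≤-refl })
matOf-bounds {a} {b ∷ l} (1≤a ∷ pl) = subst MatBounds (sym (matOf-∷ a (b ∷ l))) (record
  { P′≤P  = ℕₚ.+-mono-≤ (ℕₚ.*-monoʳ-≤ a P′≤P) Q′≤Q
  ; Q′≤Q  = P′≤P
  ; Q≤P   = ℕₚ.≤-trans (ℕₚ.m≤n*m _ a {{>-nonZero 1≤a}}) (ℕₚ.m≤m+n _ _)
  ; Q′≤P′ = ℕₚ.≤-trans (ℕₚ.m≤n*m _ a {{>-nonZero 1≤a}}) (ℕₚ.m≤m+n _ _)
  ; 1≤Q   = ℕₚ.≤-trans 1≤Q Q≤P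
  ; 1≤P′  = ℕₚ.≤-trans 1≤P′ (ℕₚ.≤-trans (ℕₚ.m≤n*m _ a {{>-nonZero 1≤a}}) (ℕₚ.m≤m+n _ _))
  })
  where open MatBounds (matOf-bounds pl)

-- Periods

EvenLength-++ : ∀ {a b} → EvenLength a → EvenLength b → EvenLength (a ++ b)
EvenLength-++ []        eb = eb
EvenLength-++ (cons₂ ea) eb = cons₂ (EvenLength-++ ea eb)

EvenLength-^ʷ : ∀ {w} → EvenLength w → ∀ k → EvenLength (w ^ʷ k)
EvenLength-^ʷ ew zero    = []
EvenLength-^ʷ ew (suc k) = EvenLength-++ ew (EvenLength-^ʷ ew k)

AllPositive-++ : ∀ {a b} → AllPositive a → AllPositive b → AllPositive (a ++ b)
AllPositive-++ = Allₚ.++⁺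

AllPositive-^ʷ : ∀ {w} → AllPositive w → ∀ k → AllPositive (w ^ʷ k)
AllPositive-^ʷ pw zero    = []
AllPositive-^ʷ pw (suc k) = AllPositive-++ pw (AllPositive-^ʷ pw k)

EvenLength-reverse : ∀ {l} → EvenLength l → EvenLength (reverse l)
EvenLength-reverse []                    = []
EvenLength-reverse (cons₂ {a} {b} {l} e) =
  subst EvenLength (sym (reverse-++ (a ∷ b ∷ []) l)) (EvenLength-++ (EvenLength-reverse e) (cons₂ []))

AllPositive-reverse : ∀ {l} → AllPositive l → AllPositive (reverse l)
AllPositive-reverse []                 = []
AllPositive-reverse {a ∷ l} (1≤a ∷ pl) =
  subst AllPositive (sym (reverse-++ (a ∷ []) l)) (AllPositive-++ (AllPositive-reverse pl) (1≤a ∷ []))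

length-^ʷ : ∀ w k → length (w ^ʷ k) ≡ k * length w
length-^ʷ w zero    = refl
length-^ʷ w (suc k) = trans (length-++ w) (cong (λ n → length w + n) (length-^ʷ w k))

commutes-^ʷ : ∀ {a b} → a ++ b ≡ b ++ a → ∀ k → (a ^ʷ k) ++ b ≡ b ++ (a ^ʷ k)
commutes-^ʷ {a} {b} ab≡ba zero    = sym (++-identityʳ b)
commutes-^ʷ {a} {b} ab≡ba (suc k) = begin
  (a ++ a ^ʷ k) ++ b  ≡⟨ ++-assoc a (a ^ʷ k) b ⟩
  a ++ (a ^ʷ k ++ b)  ≡⟨ cong (a ++_) (commutes-^ʷ ab≡ba k) ⟩
  a ++ (b ++ a ^ʷ k)  ≡⟨ ++-assoc a b (a ^ʷ k) ⟨
  (a ++ b) ++ a ^ʷ k  ≡⟨ cong (_++ a ^ʷ k) ab≡ba ⟩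
  (b ++ a) ++ a ^ʷ k  ≡⟨ ++-assoc b a (a ^ʷ k) ⟩
  b ++ (a ++ a ^ʷ k)  ∎
  where open ≡-Reasoning

act-^ʷ-comm : ∀ w k t → act (w ^ʷ k) (act w t) ≡ act w (act (w ^ʷ k) t)
act-^ʷ-comm w k t = begin
  act (w ^ʷ k) (act w t)  ≡⟨ act-++ (w ^ʷ k) w t ⟨
  act (w ^ʷ k ++ w) t     ≡⟨ cong (λ l → act l t) (commutes-^ʷ refl k) ⟩
  act (w ++ w ^ʷ k) t     ≡⟨ act-++ w (w ^ʷ k) t ⟩
  act w (act (w ^ʷ k) t)  ∎
  where open ≡-Reasoning

reverse-^ʷ : ∀ w k → reverse (w ^ʷ k) ≡ reverse w ^ʷ k
reverse-^ʷ w zero    = refl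
reverse-^ʷ w (suc k) = begin
  reverse (w ++ w ^ʷ k)              ≡⟨ reverse-++ w (w ^ʷ k) ⟩
  reverse (w ^ʷ k) ++ reverse w      ≡⟨ cong (_++ reverse w) (reverse-^ʷ w k) ⟩
  reverse w ^ʷ k ++ reverse w        ≡⟨ commutes-^ʷ refl k ⟩
  reverse w ++ reverse w ^ʷ k        ∎
  where open ≡-Reasoning

++-cancel-prefix : ∀ (a b c d : List ℕ) → length a ≡ length c → a ++ b ≡ c ++ d → a ≡ c
++-cancel-prefix []      b []      d _ _ = refl
++-cancel-prefix (x ∷ a) b (y ∷ c) d |a|≡|c| eq =
  cong₂ _∷_ (∷-injectiveˡ eq) (++-cancel-prefix a b c d (ℕₚ.suc-injective |a|≡|c|) (∷-injectiveʳ eq))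

record IsPeriod (p : List ℕ) : Set where
  field
    even     : EvenLength p
    positive : AllPositive p
    nonEmpty : 1 ≤ length p

IsPeriod-bounds : ∀ {p} → IsPeriod p → MatBounds (matOf p)
IsPeriod-bounds {a ∷ l} pp = matOf-bounds (IsPeriod.positive pp)

IsPeriod-++ : ∀ {a b} → IsPeriod a → IsPeriod b → IsPeriod (a ++ b)
IsPeriod-++ {a} {b} pa pb = record
  { even     = EvenLength-++ (IsPeriod.even pa) (IsPeriod.even pb)
  ; positive = AllPositive-++ (IsPeriod.positive pa) (IsPeriod.positive pb)
  ; nonEmpty = ℕₚ.≤-trans (IsPeriod.nonEmpty pa) (subst (length a ≤_) (sym (length-++ a)) (ℕₚ.m≤m+n _ _))
  }

IsPeriod-^ʷ : ∀ {w} → IsPeriod w → ∀ k → IsPeriod (w ^ʷ suc k)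
IsPeriod-^ʷ {w} pw zero    = subst IsPeriod (sym (++-identityʳ w)) pw
IsPeriod-^ʷ {w} pw (suc k) = IsPeriod-++ pw (IsPeriod-^ʷ pw k)

IsPeriod-reverse : ∀ {p} → IsPeriod p → IsPeriod (reverse p)
IsPeriod-reverse {p} pp = record
  { even     = EvenLength-reverse (IsPeriod.even pp)
  ; positive = AllPositive-reverse (IsPeriod.positive pp)
  ; nonEmpty = subst (1 ≤_) (sym (length-reverse p)) (IsPeriod.nonEmpty pp)
  }

2∣length⇒EvenLength : ∀ l → 2 ∣ length l → EvenLength l
2∣length⇒EvenLength []          _                  = []
2∣length⇒EvenLength (_ ∷ [])    (divides zero    ())
2∣length⇒EvenLength (_ ∷ [])    (divides (suc _) ())
2∣length⇒EvenLength (_ ∷ _ ∷ _) (divides zero    ())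
2∣length⇒EvenLength (_ ∷ _ ∷ l) (divides (suc q) eq) =
  cons₂ (2∣length⇒EvenLength l (divides q (ℕₚ.suc-injective (ℕₚ.suc-injective eq))))

IsMinEvenPeriod⇒IsPeriod : ∀ {p} → IsMinEvenPeriod p → IsPeriod p
IsMinEvenPeriod⇒IsPeriod {p} ((nonEmpty , positive) , 2∣|p| , _) =
  record { even = 2∣length⇒EvenLength p 2∣|p| ; positive = positive ; nonEmpty = nonEmpty }

Above-^ʷ : ∀ {w t} → EvenLength w → AllPositive w → Positive t → Above w t →
           ∀ {n} → 1 ≤ n → Above (w ^ʷ n) t
Above-^ʷ {w} {t} ew pw pt above {suc zero}    _ = subst (λ l → Above l t) (sym (++-identityʳ w)) above
Above-^ʷ {w} {t} ew pw pt above {suc (suc n)} _ =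
  subst (_≺ t) (sym (act-++ w (w ^ʷ suc n) t))
    (≺-trans (act-positive pw (act-positive (AllPositive-^ʷ pw (suc n)) pt))
      (act-mono-≺ ew (Above-^ʷ ew pw pt above {suc n} (s≤s z≤n))) above)

Below-^ʷ : ∀ {w t} → EvenLength w → AllPositive w → Positive t → Below w t →
           ∀ {n} → 1 ≤ n → Below (w ^ʷ n) t
Below-^ʷ {w} {t} ew pw pt below {suc zero}    _ = subst (λ l → Below l t) (sym (++-identityʳ w)) below
Below-^ʷ {w} {t} ew pw pt below {suc (suc n)} _ =
  subst (t ≺_) (sym (act-++ w (w ^ʷ suc n) t))
    (≺-trans pt below (act-mono-≺ ew (Below-^ʷ ew pw pt below {suc n} (s≤s z≤n))))

≼-act-^ʷ : ∀ {w t} → EvenLength w → AllPositive w → Positive t → t ≼ act w t → ∀ n → t ≼ act (w ^ʷ n) t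
≼-act-^ʷ ew pw pt t≼wt zero = ≼-refl
≼-act-^ʷ {w} {t} ew pw pt t≼wt (suc n) = subst (t ≼_) (sym (act-++ w (w ^ʷ n) t))
  (≼-trans (act-positive pw pt) t≼wt (act-mono-≼ ew (≼-act-^ʷ ew pw pt t≼wt n)))

≽-act-^ʷ : ∀ {w t} → EvenLength w → AllPositive w → Positive t → act w t ≼ t → ∀ n → act (w ^ʷ n) t ≼ t
≽-act-^ʷ ew pw pt wt≼t zero = ≼-refl
≽-act-^ʷ {w} {t} ew pw pt wt≼t (suc n) = subst (_≼ t) (sym (act-++ w (w ^ʷ n) t))
  (≼-trans (act-positive pw pt) (act-mono-≼ ew (≽-act-^ʷ ew pw pt wt≼t n)) wt≼t)

^ʷ-Above : ∀ {w t} → EvenLength w → AllPositive w → Positive t → ∀ n → Above (w ^ʷ n) t → Above w t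
^ʷ-Above {w} {t} ew pw pt n above with ≺-or-≽ (act w t) t
... | inj₁ wt≺t = wt≺t
... | inj₂ t≼wt = ⊥-elim (≺⇒⋡ above (≼-act-^ʷ ew pw pt t≼wt n))

^ʷ-Below : ∀ {w t} → EvenLength w → AllPositive w → Positive t → ∀ n → Below (w ^ʷ n) t → Below w t
^ʷ-Below {w} {t} ew pw pt n below with ≺-or-≽ t (act w t)
... | inj₁ t≺wt = t≺wt
... | inj₂ wt≼t = ⊥-elim (≺⇒⋡ below (≽-act-^ʷ ew pw pt wt≼t n))

-- x ∼ p: the infinite periodic words x x x … and p p p … coincide.
_∼_ : List ℕ → List ℕ → Set
x ∼ p = x ^ʷ length p ≡ p ^ʷ length x

∼-reverse : ∀ {x p} → x ∼ p → reverse x ∼ reverse p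
∼-reverse {x} {p} x∼p = begin
  reverse x ^ʷ length (reverse p)  ≡⟨ cong (reverse x ^ʷ_) (length-reverse p) ⟩
  reverse x ^ʷ length p            ≡⟨ reverse-^ʷ x (length p) ⟨
  reverse (x ^ʷ length p)          ≡⟨ cong reverse x∼p ⟩
  reverse (p ^ʷ length x)          ≡⟨ reverse-^ʷ p (length x) ⟩
  reverse p ^ʷ length x            ≡⟨ cong (reverse p ^ʷ_) (length-reverse x) ⟨
  reverse p ^ʷ length (reverse x)  ∎
  where open ≡-Reasoning

length-^ʷ-swap : ∀ x p → length (x ^ʷ length p) ≡ length (p ^ʷ length x)
length-^ʷ-swap x p = trans (length-^ʷ x (length p))
  (trans (ℕₚ.*-comm (length p) (length x)) (sym (length-^ʷ p (length x))))

-- Both powers are prefixes of the same length of x^|p| p^|x| = p^|x| x^|p|.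
commute⇒∼ : ∀ {x p} → x ++ p ≡ p ++ x → x ∼ p
commute⇒∼ {x} {p} xp≡px =
  ++-cancel-prefix (x ^ʷ length p) (p ^ʷ length x) (p ^ʷ length x) (x ^ʷ length p)
    (length-^ʷ-swap x p) (sym (commutes-^ʷ (sym (commutes-^ʷ xp≡px (length p))) (length x)))

Above-∼ : ∀ {x p t} → IsPeriod x → IsPeriod p → x ∼ p → Positive t → Above x t → Above p t
Above-∼ {x} {p} {t} px pp x∼p pt above = ^ʷ-Above (IsPeriod.even pp) (IsPeriod.positive pp) pt (length x)
  (subst (λ l → Above l t) x∼p
    (Above-^ʷ (IsPeriod.even px) (IsPeriod.positive px) pt above (IsPeriod.nonEmpty pp)))

Below-∼ : ∀ {x p t} → IsPeriod x → IsPeriod p → x ∼ p → Positive t → Below x t → Below p t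
Below-∼ {x} {p} {t} px pp x∼p pt below = ^ʷ-Below (IsPeriod.even pp) (IsPeriod.positive pp) pt (length x)
  (subst (λ l → Below l t) x∼p
    (Below-^ʷ (IsPeriod.even px) (IsPeriod.positive px) pt below (IsPeriod.nonEmpty pp)))

-- Separated a b: a positive rational lies strictly between [overline a] and [overline b].
Separated : List ℕ → List ℕ → Set
Separated a b = Σ Frac λ t → Positive t × Above a t × Below b t

Separated-irrefl : ∀ {a} → ¬ Separated a a
Separated-irrefl (_ , _ , above , below) = ≺⇒⋡ above (≺⇒≼ below)

Separated-asym : ∀ {a b} → Separated a b → ¬ Separated b a
Separated-asym {a} {b} (s , ps , above-a , below-b) (t , pt , above-b , below-a) =
  ≺⇒⋡ (Below-≺-Above b ps pt above-b below-b) (≺⇒≼ (Below-≺-Above a pt ps above-a below-a))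

Separated-∼ : ∀ {x y p q} → IsPeriod x → IsPeriod y → IsPeriod p → IsPeriod q →
              x ∼ p → y ∼ q → Separated x y → Separated p q
Separated-∼ px py pp pq x∼p y∼q (t , pt , above , below) =
  t , pt , Above-∼ px pp x∼p pt above , Below-∼ py pq y∼q pt below

∼⇒¬Separated : ∀ {x y} → IsPeriod x → IsPeriod y → x ∼ y → ¬ Separated x y
∼⇒¬Separated {y = y} px py x∼y = Separated-irrefl {y} ∘ Separated-∼ px py py py x∼y refl

one : Frac
one = (1 , 1)

one≥1 : AtLeastOne one
one≥1 = s≤s z≤n , s≤s z≤n

⊏⇒Separated : ∀ {a b} → EvenLength a → AllPositive a → AllPositive b → a ⊏ b → Separated a b
⊏⇒Separated {a} {b} ea pa pb a⊏b =
  t , AtLeastOne⇒Positive t≥1 , act-mono-≺ ea (a⊏b (act b one) one b1≥1 one≥1) , a⊏b (act b one) t b1≥1 t≥1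
  where
  b1≥1 : AtLeastOne (act b one)
  b1≥1 = act-atLeastOne pb one≥1
  t : Frac
  t = act a (act b one)
  t≥1 : AtLeastOne t
  t≥1 = act-atLeastOne pa b1≥1

++-swap-⊏⇒Separated : ∀ {a b} → EvenLength b → AllPositive a → AllPositive b →
                      (a ++ b) ⊏ (b ++ a) → Separated a b
++-swap-⊏⇒Separated {a} {b} eb pa pb ab⊏ba =
  act b m , AtLeastOne⇒Positive (act-atLeastOne pb m≥1) ,
  ab⊏ba′ m u m≥1 u≥1 , act-mono-≺ eb (ab⊏ba′ one u one≥1 u≥1)
  where
  ab⊏ba′ : ∀ X Y → AtLeastOne X → AtLeastOne Y → act a (act b X) ≺ act b (act a Y)
  ab⊏ba′ X Y gX gY = subst₂ _≺_ (act-++ a b X) (act-++ b a Y) (ab⊏ba X Y gX gY)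
  u : Frac
  u = act b one
  u≥1 : AtLeastOne u
  u≥1 = act-atLeastOne pb one≥1
  m : Frac
  m = act a u
  m≥1 : AtLeastOne m
  m≥1 = act-atLeastOne pa u≥1

≁⇒Separated : ∀ {x p} → IsPeriod x → IsPeriod p → ¬ x ∼ p → Separated x p ⊎ Separated p x
≁⇒Separated {x} {p} px pp x≁p =
  Sum.map (unpower (length p) (length x) px pp) (unpower (length x) (length p) pp px)
    (Sum.map (⊏⇒Separated (even-^ʷ px (length p)) (positive-^ʷ px (length p)) (positive-^ʷ pp (length x)))
             (⊏⇒Separated (even-^ʷ pp (length x)) (positive-^ʷ pp (length x)) (positive-^ʷ px (length p)))
      (first-difference (x ^ʷ length p) (p ^ʷ length x) (length-^ʷ-swap x p)
        (positive-^ʷ px (length p)) (positive-^ʷ pp (length x)) x≁p))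
  where
  even-^ʷ : ∀ {w} → IsPeriod w → ∀ k → EvenLength (w ^ʷ k)
  even-^ʷ pw = EvenLength-^ʷ (IsPeriod.even pw)
  positive-^ʷ : ∀ {w} → IsPeriod w → ∀ k → AllPositive (w ^ʷ k)
  positive-^ʷ pw = AllPositive-^ʷ (IsPeriod.positive pw)
  unpower : ∀ {a b} m n → IsPeriod a → IsPeriod b → Separated (a ^ʷ m) (b ^ʷ n) → Separated a b
  unpower m n pa pb (t , pt , above , below) =
    t , pt , ^ʷ-Above (IsPeriod.even pa) (IsPeriod.positive pa) pt m above ,
             ^ʷ-Below (IsPeriod.even pb) (IsPeriod.positive pb) pt n below

-- Comparison with the surd values

toℚᵘ-⟦⟧ : ∀ z → toℚᵘ ⟦ z ⟧ ≃ᵘ mkℚᵘ z 0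
toℚᵘ-⟦⟧ z = ℚₚ.toℚᵘ-fromℚᵘ (mkℚᵘ z 0)

<⇔toℚᵘ-< : ∀ {p q p′ q′} → toℚᵘ p ≃ᵘ p′ → toℚᵘ q ≃ᵘ q′ → p ℚ.< q ⇔ p′ ℚᵘ.< q′
<⇔toℚᵘ-< p≃ q≃ = mk⇔
  (λ p<q → ℚᵘₚ.<-respˡ-≃ p≃ (ℚᵘₚ.<-respʳ-≃ q≃ (ℚₚ.toℚᵘ-mono-< p<q)))
  (λ p′<q′ → ℚₚ.toℚᵘ-cancel-< (ℚᵘₚ.<-respˡ-≃ (ℚᵘₚ.≃-sym p≃) (ℚᵘₚ.<-respʳ-≃ (ℚᵘₚ.≃-sym q≃) p′<q′)))

mkℚᵘ-<⇔ : ∀ {a b k l} → mkℚᵘ a k ℚᵘ.< mkℚᵘ b l ⇔ a ℤ.* + suc l ℤ.< b ℤ.* + suc k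
mkℚᵘ-<⇔ = mk⇔ (λ { (*<* h) → h }) *<*

-- The numerator of shift x (n / d), whose denominator is d.
shiftNum : Surd → ℤ → ℕ → ℤ
shiftNum (surd A _ Q) n d = + (2 * Q) ℤ.* n ℤ.- A ℤ.* + d

private
  shift-ring : ∀ c n A d → (c ℤ.* n ℤ.* + 1 ℤ.+ ℤ.- A ℤ.* d) ℤ.* d ≡ (c ℤ.* n ℤ.- A ℤ.* d) ℤ.* d
  shift-ring = ℤ-Solver.solve-∀

  shift-normal : ∀ A Q n dm → mkℚᵘ (+ (2 * Q)) 0 ℚᵘ.* mkℚᵘ n dm ℚᵘ.+ ℚᵘ.- mkℚᵘ A 0
                              ≃ᵘ mkℚᵘ (+ (2 * Q) ℤ.* n ℤ.- A ℤ.* + suc dm) dm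
  shift-normal A Q n dm = *≡* (begin
    (+ (2 * Q) ℤ.* n ℤ.* + 1 ℤ.+ ℤ.- A ℤ.* + (1 * suc dm)) ℤ.* + suc dm
      ≡⟨ cong (λ k → (+ (2 * Q) ℤ.* n ℤ.* + 1 ℤ.+ ℤ.- A ℤ.* + k) ℤ.* + suc dm) (ℕₚ.*-identityˡ (suc dm)) ⟩
    (+ (2 * Q) ℤ.* n ℤ.* + 1 ℤ.+ ℤ.- A ℤ.* + suc dm) ℤ.* + suc dm
      ≡⟨ shift-ring (+ (2 * Q)) n A (+ suc dm) ⟩
    (+ (2 * Q) ℤ.* n ℤ.- A ℤ.* + suc dm) ℤ.* + suc dm
      ≡⟨ cong (λ k → (+ (2 * Q) ℤ.* n ℤ.- A ℤ.* + suc dm) ℤ.* + k)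
              (sym (trans (ℕₚ.*-identityʳ _) (ℕₚ.*-identityˡ (suc dm)))) ⟩
    (+ (2 * Q) ℤ.* n ℤ.- A ℤ.* + suc dm) ℤ.* + (1 * suc dm * 1) ∎)
    where open ≡-Reasoning

shift-toℚᵘ : ∀ x {t n dm} → toℚᵘ t ≃ᵘ mkℚᵘ n dm → toℚᵘ (shift x t) ≃ᵘ mkℚᵘ (shiftNum x n (suc dm)) dm
shift-toℚᵘ (surd A D Q) {t} {n} {dm} t≃ =
  ℚᵘₚ.≃-trans (ℚₚ.toℚᵘ-homo-+ (⟦ + (2 * Q) ⟧ ℚ.* t) (ℚ.- ⟦ A ⟧))
    (ℚᵘₚ.≃-trans
      (ℚᵘₚ.+-cong (ℚᵘₚ.≃-trans (ℚₚ.toℚᵘ-homo-* ⟦ + (2 * Q) ⟧ t) (ℚᵘₚ.*-cong (toℚᵘ-⟦⟧ (+ (2 * Q))) t≃))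
                  (ℚᵘₚ.≃-trans (ℚₚ.toℚᵘ-homo‿- ⟦ A ⟧) (ℚᵘₚ.-‿cong (toℚᵘ-⟦⟧ A))))
      (shift-normal A Q n dm))

module _ (x : Surd) {t : ℚ} {n : ℤ} {dm : ℕ} (t≃ : toℚᵘ t ≃ᵘ mkℚᵘ n dm) where
  private
    G : ℤ
    G = shiftNum x n (suc dm)
    S≃ : toℚᵘ (shift x t) ≃ᵘ mkℚᵘ G dm
    S≃ = shift-toℚᵘ x t≃
    S²≃ : toℚᵘ (shift x t ℚ.* shift x t) ≃ᵘ mkℚᵘ G dm ℚᵘ.* mkℚᵘ G dm
    S²≃ = ℚᵘₚ.≃-trans (ℚₚ.toℚᵘ-homo-* (shift x t) (shift x t)) (ℚᵘₚ.*-cong S≃ S≃)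
    d² : + (suc dm * suc dm) ≡ + suc dm ℤ.* + suc dm
    d² = ℤₚ.pos-* (suc dm) (suc dm)

  0<shift⇔ : ℚ.0ℚ ℚ.< shift x t ⇔ + 0 ℤ.< G
  0<shift⇔ = mk⇔
    (λ h → subst (+ 0 ℤ.<_) (ℤₚ.*-identityʳ G) (to mkℚᵘ-<⇔ (to (<⇔toℚᵘ-< ℚᵘₚ.≃-refl S≃) h)))
    (λ h → from (<⇔toℚᵘ-< ℚᵘₚ.≃-refl S≃) (from mkℚᵘ-<⇔ (subst (+ 0 ℤ.<_) (sym (ℤₚ.*-identityʳ G)) h)))

  shift<0⇒ : shift x t ℚ.< ℚ.0ℚ → G ℤ.< + 0
  shift<0⇒ h = subst (ℤ._< + 0) (ℤₚ.*-identityʳ G) (to mkℚᵘ-<⇔ (to (<⇔toℚᵘ-< S≃ ℚᵘₚ.≃-refl) h))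

  shift²<D⇔ : shift x t ℚ.* shift x t ℚ.< ⟦ Surd.D x ⟧ ⇔ G ℤ.* G ℤ.< Surd.D x ℤ.* (+ suc dm ℤ.* + suc dm)
  shift²<D⇔ = mk⇔
    (λ h → subst₂ ℤ._<_ (ℤₚ.*-identityʳ (G ℤ.* G)) (cong (Surd.D x ℤ.*_) d²)
             (to mkℚᵘ-<⇔ (to (<⇔toℚᵘ-< S²≃ (toℚᵘ-⟦⟧ (Surd.D x))) h)))
    (λ h → from (<⇔toℚᵘ-< S²≃ (toℚᵘ-⟦⟧ (Surd.D x))) (from mkℚᵘ-<⇔
             (subst₂ ℤ._<_ (sym (ℤₚ.*-identityʳ (G ℤ.* G))) (cong (Surd.D x ℤ.*_) (sym d²)) h)))

  D<shift²⇔ : ⟦ Surd.D x ⟧ ℚ.< shift x t ℚ.* shift x t ⇔ Surd.D x ℤ.* (+ suc dm ℤ.* + suc dm) ℤ.< G ℤ.* G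
  D<shift²⇔ = mk⇔
    (λ h → subst₂ ℤ._<_ (cong (Surd.D x ℤ.*_) d²) (ℤₚ.*-identityʳ (G ℤ.* G))
             (to mkℚᵘ-<⇔ (to (<⇔toℚᵘ-< (toℚᵘ-⟦⟧ (Surd.D x)) S²≃) h)))
    (λ h → from (<⇔toℚᵘ-< (toℚᵘ-⟦⟧ (Surd.D x)) S²≃) (from mkℚᵘ-<⇔
             (subst₂ ℤ._<_ (cong (Surd.D x ℤ.*_) (sym d²)) (sym (ℤₚ.*-identityʳ (G ℤ.* G))) h)))

private
  +-cancelʳ-<ℤ : ∀ {a b} c → a ℤ.+ c ℤ.< b ℤ.+ c → a ℤ.< b
  +-cancelʳ-<ℤ {a} {b} c h = subst₂ ℤ._<_ (add-sub a c) (add-sub b c) (ℤₚ.+-monoˡ-< (ℤ.- c) h)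
    where
    add-sub : ∀ a c → a ℤ.+ c ℤ.+ ℤ.- c ≡ a
    add-sub = ℤ-Solver.solve-∀

  balance-< : ∀ {a b c e} → a ℤ.+ c ≡ b ℤ.+ e → c ℤ.< e ⇔ b ℤ.< a
  balance-< {a} {b} {c} {e} a+c≡b+e = mk⇔
    (λ c<e → +-cancelʳ-<ℤ c (subst (b ℤ.+ c ℤ.<_) (sym a+c≡b+e) (ℤₚ.+-monoʳ-< b c<e)))
    (λ b<a → +-cancelʳ-<ℤ b (subst₂ ℤ._<_ (ℤₚ.+-comm b c) (trans a+c≡b+e (ℤₚ.+-comm b e))
                                          (ℤₚ.+-monoˡ-< c b<a)))

  cast-lin : ∀ a b c e → + (a * b + c * e) ≡ + a ℤ.* + b ℤ.+ + c ℤ.* + e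
  cast-lin a b c e = trans (ℤₚ.pos-+ (a * b) _) (cong₂ ℤ._+_ (ℤₚ.pos-* a b) (ℤₚ.pos-* c e))

  cast-4Q : ∀ Q m → + (4 * Q * m) ≡ + 4 ℤ.* + Q ℤ.* + m
  cast-4Q Q m = trans (ℤₚ.pos-* (4 * Q) m) (cong (ℤ._* + m) (ℤₚ.pos-* 4 Q))

  surd-ring : ∀ P P′ Q Q′ x d →
    (+ 2 ℤ.* Q ℤ.* x ℤ.- (P ℤ.- Q′) ℤ.* d) ℤ.* (+ 2 ℤ.* Q ℤ.* x ℤ.- (P ℤ.- Q′) ℤ.* d)
      ℤ.+ + 4 ℤ.* Q ℤ.* ((P ℤ.* x ℤ.+ P′ ℤ.* d) ℤ.* d)
    ≡ ((P ℤ.- Q′) ℤ.* (P ℤ.- Q′) ℤ.+ + 4 ℤ.* Q ℤ.* P′) ℤ.* (d ℤ.* d)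
      ℤ.+ + 4 ℤ.* Q ℤ.* (x ℤ.* (Q ℤ.* x ℤ.+ Q′ ℤ.* d))
  surd-ring = ℤ-Solver.solve-∀

  shift-linear : ∀ c n A d → c ℤ.* n ℤ.- A ℤ.* d ℤ.+ A ℤ.* d ≡ c ℤ.* n
  shift-linear = ℤ-Solver.solve-∀

  shift-slope : ∀ P Q Q′ x d →
    + 2 ℤ.* Q ℤ.* x ℤ.- (P ℤ.- Q′) ℤ.* d ℤ.+ P ℤ.* d ≡ + 2 ℤ.* Q ℤ.* x ℤ.+ Q′ ℤ.* d
  shift-slope = ℤ-Solver.solve-∀

module _ (w : List ℕ) where
  private
    M : Mat
    M = matOf w
    open Mat M renaming (m11 to P; m12 to P′; m21 to Q; m22 to Q′)
    A D : ℤ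
    A = Surd.A (val w)
    D = Surd.D (val w)
    G : ℕ → ℕ → ℤ
    G x d = shiftNum (val w) (+ x) d

  -- (2 Q x − A d)² − D d² = 4 Q (x den − num d): testing t = x / d against the fixed
  -- point is testing shift (val w) t against √D.
  fixedPoint-identity : ∀ x d →
    G x d ℤ.* G x d ℤ.+ + (4 * Q * (num M x d * d)) ≡
    D ℤ.* (+ d ℤ.* + d) ℤ.+ + (4 * Q * (x * den M x d))
  fixedPoint-identity x d = begin
    G x d ℤ.* G x d ℤ.+ + (4 * Q * (num M x d * d))
      ≡⟨ cong₂ (λ g r → g ℤ.* g ℤ.+ r) (cong (λ c → c ℤ.* + x ℤ.- A ℤ.* + d) (ℤₚ.pos-* 2 Q))
               (trans (cast-4Q Q _) (cong (+ 4 ℤ.* + Q ℤ.*_)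
                 (trans (ℤₚ.pos-* (num M x d) d) (cong (ℤ._* + d) (cast-lin P x P′ d))))) ⟩
    _ ≡⟨ surd-ring (+ P) (+ P′) (+ Q) (+ Q′) (+ x) (+ d) ⟩
    _ ≡⟨ cong (λ r → D ℤ.* (+ d ℤ.* + d) ℤ.+ r) (sym (trans (cast-4Q Q _) (cong (+ 4 ℤ.* + Q ℤ.*_)
           (trans (ℤₚ.pos-* x (den M x d)) (cong (+ x ℤ.*_) (cast-lin Q x Q′ d)))))) ⟩
    D ℤ.* (+ d ℤ.* + d) ℤ.+ + (4 * Q * (x * den M x d)) ∎
    where open ≡-Reasoning

  4Q-<⇔ : 1 ≤ Q → ∀ {m n} → m < n ⇔ + (4 * Q * m) ℤ.< + (4 * Q * n)
  4Q-<⇔ 1≤Q {m} {n} = mk⇔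
    (λ m<n → +<+ (ℕₚ.*-monoʳ-< (4 * Q) {{>-nonZero (ℕₚ.*-mono-< {0} {4} (s≤s z≤n) 1≤Q)}} m<n))
    (λ h → ℕₚ.*-cancelˡ-< (4 * Q) m n (ℤₚ.drop‿+<+ h))

  AboveFix⇔D<G² : 1 ≤ Q → ∀ x d → AboveFix M (x , d) ⇔ D ℤ.* (+ d ℤ.* + d) ℤ.< G x d ℤ.* G x d
  AboveFix⇔D<G² 1≤Q x d = ⇔-trans (4Q-<⇔ 1≤Q) (balance-< (fixedPoint-identity x d))

  BelowFix⇔G²<D : 1 ≤ Q → ∀ x d → BelowFix M (x , d) ⇔ G x d ℤ.* G x d ℤ.< D ℤ.* (+ d ℤ.* + d)
  BelowFix⇔G²<D 1≤Q x d = ⇔-trans (4Q-<⇔ 1≤Q) (balance-< (sym (fixedPoint-identity x d)))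

  private
    G+Pd : ∀ x d → G x d ℤ.+ + (P * d) ≡ + (2 * Q * x + Q′ * d)
    G+Pd x d = begin
      G x d ℤ.+ + (P * d)
        ≡⟨ cong₂ (λ c p → c ℤ.* + x ℤ.- A ℤ.* + d ℤ.+ p) (ℤₚ.pos-* 2 Q) (ℤₚ.pos-* P d) ⟩
      _ ≡⟨ shift-slope (+ P) (+ Q) (+ Q′) (+ x) (+ d) ⟩
      + 2 ℤ.* + Q ℤ.* + x ℤ.+ + Q′ ℤ.* + d
        ≡⟨ cong (ℤ._+ + Q′ ℤ.* + d) (cong (ℤ._* + x) (sym (ℤₚ.pos-* 2 Q))) ⟩
      + (2 * Q) ℤ.* + x ℤ.+ + Q′ ℤ.* + d
        ≡⟨ sym (cast-lin (2 * Q) x Q′ d) ⟩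
      + (2 * Q * x + Q′ * d) ∎
      where open ≡-Reasoning

  AboveFix⇒0<G : ∀ {x d} → AboveFix M (x , d) → + 0 ℤ.< G x d
  AboveFix⇒0<G {x} {d} above = +-cancelʳ-<ℤ (+ (P * d))
    (subst (+ (P * d) ℤ.<_) (sym (G+Pd x d))
      (+<+ (ℕₚ.<-≤-trans (AboveFix⇒slope M above)
        (ℕₚ.+-monoˡ-≤ (Q′ * d) (ℕₚ.*-monoˡ-≤ x (ℕₚ.m≤m+n Q _))))))

  G<0⇒BelowFix : ∀ {x d} → 0 < x → G x d ℤ.< + 0 → BelowFix M (x , d)
  G<0⇒BelowFix {x} {d} x>0 G<0 = begin-strict
    x * (Q * x + Q′ * d)      ≤⟨ ℕₚ.*-monoʳ-≤ x (ℕₚ.+-monoˡ-≤ (Q′ * d) (ℕₚ.*-monoˡ-≤ x (ℕₚ.m≤m+n Q _))) ⟩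
    x * (2 * Q * x + Q′ * d)  <⟨ ℕₚ.*-monoʳ-< x {{>-nonZero x>0}} slope<Pd ⟩
    x * (P * d)               ≤⟨ num-lower M x d ⟩
    num M x d * d             ∎
    where
    open ℕₚ.≤-Reasoning
    slope<Pd : 2 * Q * x + Q′ * d < P * d
    slope<Pd = ℤₚ.drop‿+<+ (subst (ℤ._< + (P * d)) (G+Pd x d)
      (subst (G x d ℤ.+ + (P * d) ℤ.<_) (ℤₚ.+-identityˡ _) (ℤₚ.+-monoˡ-< (+ (P * d)) G<0)))

  shiftNum≤0 : Q′ ≤ P → ∀ {n} d → n ℤ.≤ + 0 → shiftNum (val w) n d ℤ.≤ + 0
  shiftNum≤0 Q′≤P {n} d n≤0 = begin
    shiftNum (val w) n d                       ≤⟨ ℤₚ.i≤i+j _ (+ ((P ∸ Q′) * d)) ⟩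
    shiftNum (val w) n d ℤ.+ + ((P ∸ Q′) * d)  ≡⟨ cong (λ r → shiftNum (val w) n d ℤ.+ r) A·d ⟨
    shiftNum (val w) n d ℤ.+ A ℤ.* + d         ≡⟨ shift-linear (+ (2 * Q)) n A (+ d) ⟩
    + (2 * Q) ℤ.* n                            ≤⟨ ℤₚ.*-monoˡ-≤-nonNeg (+ (2 * Q)) n≤0 ⟩
    + (2 * Q) ℤ.* + 0                          ≡⟨ ℤₚ.*-zeroʳ (+ (2 * Q)) ⟩
    + 0                                        ∎
    where
    open ℤₚ.≤-Reasoning
    A·d : A ℤ.* + d ≡ + ((P ∸ Q′) * d)
    A·d = trans (cong (ℤ._* + d) (trans (ℤₚ.m-n≡m⊖n P Q′) (ℤₚ.⊖-≥ Q′≤P))) (sym (ℤₚ.pos-* (P ∸ Q′) d))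

  0<shiftNum⇒positive : Q′ ≤ P → ∀ n d → + 0 ℤ.< shiftNum (val w) n d → Σ ℕ λ x → n ≡ + x × 0 < x
  0<shiftNum⇒positive Q′≤P (+ suc x) d _   = suc x , refl , s≤s z≤n
  0<shiftNum⇒positive Q′≤P (+ zero)  d 0<G = ⊥-elim (ℤₚ.<⇒≱ 0<G (shiftNum≤0 Q′≤P d (+≤+ z≤n)))
  0<shiftNum⇒positive Q′≤P -[1+ k ]  d 0<G = ⊥-elim (ℤₚ.<⇒≱ 0<G (shiftNum≤0 Q′≤P d -≤+))

module _ (w : List ℕ) (bounds : MatBounds (matOf w)) where
  private
    open MatBounds bounds
    Q′≤P : Mat.m22 (matOf w) ≤ Mat.m11 (matOf w)
    Q′≤P = ℕₚ.≤-trans Q′≤Q Q≤P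

  Above⇒ˢ< : ∀ {x dm r} → toℚᵘ r ≃ᵘ mkℚᵘ (+ x) dm → Above w (x , suc dm) → val w ˢ< r
  Above⇒ˢ< {x} {dm} r≃ above =
    from (0<shift⇔ (val w) r≃) (AboveFix⇒0<G w fix) ,
    from (D<shift²⇔ (val w) r≃) (to (AboveFix⇔D<G² w 1≤Q x (suc dm)) fix)
    where
    fix : AboveFix (matOf w) (x , suc dm)
    fix = to (Above⇔AboveFix w (x , suc dm)) above

  ˢ<⇒Above : ∀ {n dm r} → toℚᵘ r ≃ᵘ mkℚᵘ n dm → val w ˢ< r →
             Σ ℕ λ x → n ≡ + x × 0 < x × Above w (x , suc dm)
  ˢ<⇒Above {n} {dm} r≃ (0<S , D<S²)
    with 0<shiftNum⇒positive w Q′≤P n (suc dm) (to (0<shift⇔ (val w) r≃) 0<S)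
  ... | x , refl , x>0 = x , refl , x>0 ,
    from (Above⇔AboveFix w (x , suc dm))
      (from (AboveFix⇔D<G² w 1≤Q x (suc dm)) (to (D<shift²⇔ (val w) r≃) D<S²))

  Below⇒<ˢ : ∀ {x dm r} → toℚᵘ r ≃ᵘ mkℚᵘ (+ x) dm → Below w (x , suc dm) → r <ˢ val w
  Below⇒<ˢ {x} {dm} r≃ below = inj₂ (from (shift²<D⇔ (val w) r≃)
    (to (BelowFix⇔G²<D w 1≤Q x (suc dm)) (to (Below⇔BelowFix w (x , suc dm)) below)))

  <ˢ⇒Below : ∀ {x dm r} → toℚᵘ r ≃ᵘ mkℚᵘ (+ x) dm → 0 < x → r <ˢ val w → Below w (x , suc dm)
  <ˢ⇒Below {x} {dm} r≃ x>0 (inj₁ S<0) =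
    from (Below⇔BelowFix w (x , suc dm)) (G<0⇒BelowFix w x>0 (shift<0⇒ (val w) r≃ S<0))
  <ˢ⇒Below {x} {dm} r≃ x>0 (inj₂ S²<D) =
    from (Below⇔BelowFix w (x , suc dm))
      (from (BelowFix⇔G²<D w 1≤Q x (suc dm)) (to (shift²<D⇔ (val w) r≃) S²<D))

Separated⇒<ᴿ : ∀ {a b} → IsPeriod a → IsPeriod b → Separated a b → val a <ᴿ val b
Separated⇒<ᴿ {a} {b} pa pb ((x , suc dm) , _ , above , below) =
  r , Above⇒ˢ< a (IsPeriod-bounds pa) r≃ above , Below⇒<ˢ b (IsPeriod-bounds pb) r≃ below
  where
  r : ℚ
  r = fromℚᵘ (mkℚᵘ (+ x) dm)
  r≃ : toℚᵘ r ≃ᵘ mkℚᵘ (+ x) dm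
  r≃ = ℚₚ.toℚᵘ-fromℚᵘ (mkℚᵘ (+ x) dm)

<ᴿ⇒Separated : ∀ {a b} → IsPeriod a → IsPeriod b → val a <ᴿ val b → Separated a b
<ᴿ⇒Separated {a} {b} pa pb (mkℚ n dm _ , above , below)
  with ˢ<⇒Above a (IsPeriod-bounds pa) ℚᵘₚ.≃-refl above
... | x , refl , x>0 , above′ =
  (x , suc dm) , (x>0 , s≤s z≤n) , above′ , <ˢ⇒Below b (IsPeriod-bounds pb) ℚᵘₚ.≃-refl x>0 below

≈ᴿ⇒∼ : ∀ {x p} → IsPeriod x → IsPeriod p → val x ≈ᴿ val p → x ∼ p
≈ᴿ⇒∼ {x} {p} px pp (x≮p , p≮x) with ≡-dec ℕₚ._≟_ (x ^ʷ length p) (p ^ʷ length x)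
... | yes x∼p = x∼p
... | no x≁p  = ⊥-elim ([ x≮p ∘ Separated⇒<ᴿ px pp , p≮x ∘ Separated⇒<ᴿ pp px ] (≁⇒Separated px pp x≁p))

-- The four inequalities

module Witnesses {p q} (pp : IsPeriod p) (pq : IsPeriod q) {t₀} (pt₀ : Positive t₀)
         (above₀ : Above p t₀) (below₀ : Below q t₀) where
  private
    open IsPeriod pp renaming (even to ep; positive to ap)
    open IsPeriod pq renaming (even to eq; positive to aq)

    t₀≥1 : AtLeastOne t₀
    t₀≥1 = Above⇒AtLeastOne ap (IsPeriod.nonEmpty pp) pt₀ above₀

  -- If q p came first, s = act q t₀ would satisfy act p s ≺ s ≺ act p s.
  pq⊏qp : (p ++ q) ⊏ (q ++ p)
  pq⊏qp with ≡-dec ℕₚ._≟_ (p ++ q) (q ++ p)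
  ... | yes pq≡qp = ⊥-elim (∼⇒¬Separated pp pq (commute⇒∼ {p} {q} pq≡qp) (t₀ , pt₀ , above₀ , below₀))
  ... | no pq≢qp with first-difference (p ++ q) (q ++ p) (length-++-comm p q)
                        (AllPositive-++ ap aq) (AllPositive-++ aq ap) pq≢qp
  ...   | inj₁ pq⊏qp′ = pq⊏qp′
  ...   | inj₂ qp⊏pq  = ⊥-elim (≺⇒⋡ (Below-≺-Above q ps pz above-q-z below-q-s) (≺⇒≼ above-p-s))
    where
    s = act q t₀
    z = act p s
    ps : Positive s
    ps = act-positive aq pt₀
    pz : Positive z
    pz = act-positive ap ps
    above-q-z : Above q z
    above-q-z = subst₂ _≺_ (act-++ q p s) (act-++ p q t₀)
      (qp⊏pq s t₀ (act-atLeastOne aq t₀≥1) t₀≥1)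
    below-q-s : Below q s
    below-q-s = act-mono-≺ eq below₀
    above-p-s : Above p s
    above-p-s = Above-upward p pt₀ ps (≺⇒≼ below₀) above₀

  private
    pq⊏qp′ : ∀ X Y → AtLeastOne X → AtLeastOne Y → act p (act q X) ≺ act q (act p Y)
    pq⊏qp′ X Y gX gY = subst₂ _≺_ (act-++ p q X) (act-++ q p Y) (pq⊏qp X Y gX gY)

    s₀ : Frac
    s₀ = act p t₀
    ps₀ : Positive s₀
    ps₀ = act-positive ap pt₀
    s₀≥1 : AtLeastOne s₀
    s₀≥1 = act-atLeastOne ap t₀≥1
    above-p-s₀ : Above p s₀
    above-p-s₀ = act-mono-≺ ep above₀
    below-q-s₀ : Below q s₀
    below-q-s₀ = Below-downward q (MatBounds.1≤P′ (IsPeriod-bounds pq)) ps₀ pt₀ (≺⇒≼ above₀) below₀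

    β : Frac
    β = act q s₀
    β≥1 : AtLeastOne β
    β≥1 = act-atLeastOne aq s₀≥1

  below-q-p^k : ∀ k → Below (q ++ p ^ʷ k) s₀
  below-q-p^k k =
    subst (s₀ ≺_) (sym (trans (act-++ q (p ^ʷ k) s₀) (cong (act q) (act-^ʷ-comm p k t₀))))
      (≺-trans ps₀ (act-mono-≺ ep below₀)
        (pq⊏qp′ t₀ (act (p ^ʷ k) t₀) t₀≥1 (act-atLeastOne (AllPositive-^ʷ ap k) t₀≥1)))

  separated-p-qp^k : ∀ k → Separated p (q ++ p ^ʷ k)
  separated-p-qp^k k = s₀ , ps₀ , above-p-s₀ , below-q-p^k k

  separated-p-p^kq : ∀ k → Separated p (p ^ʷ k ++ q)
  separated-p-p^kq k =
    act (p ^ʷ k) s₀ , act-positive (AllPositive-^ʷ ap k) ps₀ ,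
    subst (_≺ act (p ^ʷ k) s₀) (act-^ʷ-comm p k s₀) (act-mono-≺ (EvenLength-^ʷ ep k) above-p-s₀) ,
    subst (act (p ^ʷ k) s₀ ≺_)
      (sym (trans (act-++ (p ^ʷ k) q _) (cong (act (p ^ʷ k)) (sym (act-++ q (p ^ʷ k) s₀)))))
      (act-mono-≺ (EvenLength-^ʷ ep k) (below-q-p^k k))

  separated-q^kp-q : ∀ k → Separated (q ^ʷ k ++ p) q
  separated-q^kp-q k =
    act (q ^ʷ k) β , act-positive (AllPositive-^ʷ aq k) (AtLeastOne⇒Positive β≥1) ,
    subst (_≺ act (q ^ʷ k) β) (sym (act-++ (q ^ʷ k) p _))
      (act-mono-≺ (EvenLength-^ʷ eq k)
        (subst (_≺ β) (cong (act p) (sym (act-^ʷ-comm q k s₀)))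
          (pq⊏qp′ (act (q ^ʷ k) s₀) t₀ (act-atLeastOne (AllPositive-^ʷ aq k) s₀≥1) t₀≥1))) ,
    subst (act (q ^ʷ k) β ≺_) (act-^ʷ-comm q k β) (act-mono-≺ (EvenLength-^ʷ eq k) (act-mono-≺ eq below-q-s₀))

  separated-pq^k-q : ∀ k → Separated (p ++ q ^ʷ suc k) q
  separated-pq^k-q k =
    β , AtLeastOne⇒Positive β≥1 ,
    subst (_≺ β) (sym (trans (act-++ p (q ^ʷ suc k) β) (cong (act p) (act-++ q (q ^ʷ k) β))))
      (pq⊏qp′ (act (q ^ʷ k) β) t₀ (act-atLeastOne (AllPositive-^ʷ aq k) β≥1) t₀≥1) ,
    act-mono-≺ eq below-q-s₀

fourInequalities : ∀ {p q} → IsPeriod p → IsPeriod q → Separated p q → ∀ k → 1 ≤ k → FourIneqs p q k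
fourInequalities pp pq (t₀ , pt₀ , above₀ , below₀) (suc k) _ =
  Separated⇒<ᴿ pp (IsPeriod-++ pq (IsPeriod-^ʷ pp k)) (separated-p-qp^k (suc k)) ,
  Separated⇒<ᴿ (IsPeriod-++ (IsPeriod-^ʷ pq k) pp) pq (separated-q^kp-q (suc k)) ,
  Separated⇒<ᴿ pp (IsPeriod-++ (IsPeriod-^ʷ pp k) pq) (separated-p-p^kq (suc k)) ,
  Separated⇒<ᴿ (IsPeriod-++ pp (IsPeriod-^ʷ pq k)) pq (separated-pq^k-q k)
  where open Witnesses pp pq pt₀ above₀ below₀

-- Markov words

IsPeriod-pair : ∀ {a b} → 1 ≤ a → 1 ≤ b → IsPeriod (a ∷ b ∷ [])
IsPeriod-pair 1≤a 1≤b = record { even = cons₂ [] ; positive = 1≤a ∷ 1≤b ∷ [] ; nonEmpty = s≤s z≤n }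

MarkovWord⇒IsPeriod : ∀ {a b x} → MarkovWord a b x → IsPeriod x
MarkovWord⇒IsPeriod w0 = IsPeriod-pair (s≤s z≤n) (s≤s z≤n)
MarkovWord⇒IsPeriod wh = IsPeriod-pair (s≤s z≤n) (s≤s z≤n)
MarkovWord⇒IsPeriod (wmed _ Dx Dy) = IsPeriod-++ (MarkovWord⇒IsPeriod Dy) (MarkovWord⇒IsPeriod Dx)

bezout⇒coprime : ∀ {X Y u v} → X * u ≡ Y * v + 1 → Coprime X Y
bezout⇒coprime {u = u} {v} Xu≡Yv+1 {k} (k∣X , k∣Y) =
  ∣1⇒≡1 (∣m+n∣m⇒∣n (subst (k ∣_) Xu≡Yv+1 (∣m⇒∣m*n u k∣X)) (∣m⇒∣m*n v k∣Y))

coprime-∣-small : ∀ {X Y β} → Coprime Y X → Y ∣ β * X → β < Y → β ≡ 0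
coprime-∣-small {X} {Y} {zero}  cop Y∣βX β<Y = refl
coprime-∣-small {X} {Y} {suc β} cop Y∣βX β<Y =
  ⊥-elim (>⇒∤ β<Y (coprime-divisor cop (subst (Y ∣_) (ℕₚ.*-comm (suc β) X) Y∣βX)))

private
  shift-solution : ∀ u′ β X m n v′ Y v → (u′ + β) * X + m ≡ v * Y + n → u′ * X + m ≡ v′ * Y + n →
                   v′ * Y + β * X ≡ v * Y
  shift-solution u′ β X m n v′ Y v eq eq′ = ℕₚ.+-cancelʳ-≡ n _ _ (begin
    v′ * Y + β * X + n      ≡⟨ add-swap (v′ * Y) (β * X) n ⟩
    v′ * Y + n + β * X      ≡⟨ cong (_+ β * X) eq′ ⟨
    u′ * X + m + β * X      ≡⟨ distrib u′ β X m ⟨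
    (u′ + β) * X + m        ≡⟨ eq ⟩
    v * Y + n               ∎)
    where
    open ≡-Reasoning
    add-swap : ∀ a b n → a + b + n ≡ a + n + b
    add-swap = solve-∀
    distrib : ∀ u′ β X m → (u′ + β) * X + m ≡ u′ * X + m + β * X
    distrib = solve-∀

-- Solutions of u X + m ≡ v Y + n differ by multiples of Y in u.
bezout-unique-≤ : ∀ {X Y m n u v u′ v′} → Coprime Y X →
                  u * X + m ≡ v * Y + n → u′ * X + m ≡ v′ * Y + n → u′ ≤ u → u < Y → u′ ≡ u × v′ ≡ v
bezout-unique-≤ {X} {Y} {m} {n} {u} {v} {u′} {v′} cop eq eq′ u′≤u u<Y with ℕₚ.m≤n⇒∃[o]m+o≡n u′≤u
... | β , refl = u′≡u , v′≡v
  where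
  v′Y+βX≡vY : v′ * Y + β * X ≡ v * Y
  v′Y+βX≡vY = shift-solution u′ β X m n v′ Y v eq eq′
  β≡0 : β ≡ 0
  β≡0 = coprime-∣-small cop (∣m+n∣m⇒∣n (subst (Y ∣_) (sym v′Y+βX≡vY) (n∣m*n v)) (n∣m*n v′))
                          (ℕₚ.≤-<-trans (ℕₚ.m≤n+m β u′) u<Y)
  u′≡u : u′ ≡ u′ + β
  u′≡u = sym (trans (cong (λ n → u′ + n) β≡0) (ℕₚ.+-identityʳ u′))
  v′≡v : v′ ≡ v
  v′≡v = ℕₚ.*-cancelʳ-≡ v′ v Y {{>-nonZero (ℕₚ.<-≤-trans (s≤s z≤n) u<Y)}}
    (trans (sym (ℕₚ.+-identityʳ (v′ * Y))) (trans (cong (λ k → v′ * Y + k * X) (sym β≡0)) v′Y+βX≡vY))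

bezout-unique : ∀ {X Y m n u v u′ v′} → Coprime Y X →
                u * X + m ≡ v * Y + n → u′ * X + m ≡ v′ * Y + n → u < Y → u′ < Y → u ≡ u′ × v ≡ v′
bezout-unique cop eq eq′ u<Y u′<Y with ℕₚ.≤-total _ _
... | inj₁ u′≤u = Product.map sym sym (bezout-unique-≤ cop eq eq′ u′≤u u<Y)
... | inj₂ u≤u′ = bezout-unique-≤ cop eq′ eq u≤u′ u′<Y

left-neighbor-unique : ∀ {a b a′ b′ C D} → b * C ≡ a * D + 1 → b′ * C ≡ a′ * D + 1 →
                        b < D → b′ < D → a ≡ a′ × b ≡ b′
left-neighbor-unique {a} {b} {a′} {b′} {C} {D} e e′ b<D b′<D =
  Product.swap (bezout-unique cop (trans (ℕₚ.+-identityʳ (b * C)) e) (trans (ℕₚ.+-identityʳ (b′ * C)) e′)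
                              b<D b′<D)
  where
  cop : Coprime D C
  cop = Coprimality.sym (bezout⇒coprime (trans (ℕₚ.*-comm C b) (trans e (cong (_+ 1) (ℕₚ.*-comm a D)))))

right-neighbor-unique : ∀ {c d c′ d′ C D} → D * c ≡ C * d + 1 → D * c′ ≡ C * d′ + 1 →
                         d < D → d′ < D → c ≡ c′ × d ≡ d′
right-neighbor-unique {c} {d} {c′} {d′} {C} {D} e e′ d<D d′<D =
  Product.swap (bezout-unique (bezout⇒coprime e) (flip e) (flip e′) d<D d′<D)
  where
  flip : ∀ {c d} → D * c ≡ C * d + 1 → d * C + 1 ≡ c * D + 0
  flip {c} {d} e = trans (cong (_+ 1) (ℕₚ.*-comm d C))
    (trans (sym e) (trans (ℕₚ.*-comm D c) (sym (ℕₚ.+-identityʳ (c * D)))))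

private
  mediantˡ-ring : ∀ a b d → b * a + (a * d + 1) ≡ a * (b + d) + 1
  mediantˡ-ring = solve-∀

  mediantʳ-ring : ∀ a c d → a * d + 1 + d * c ≡ (a + c) * d + 1
  mediantʳ-ring = solve-∀

Neighbors-mediantˡ : ∀ {a b c d} → Neighbors a b c d → b * (a + c) ≡ a * (b + d) + 1
Neighbors-mediantˡ {a} {b} {c} {d} (_ , _ , e) =
  trans (ℕₚ.*-distribˡ-+ b a c) (trans (cong (λ n → b * a + n) e) (mediantˡ-ring a b d))

Neighbors-mediantʳ : ∀ {a b c d} → Neighbors a b c d → (b + d) * c ≡ (a + c) * d + 1
Neighbors-mediantʳ {a} {b} {c} {d} (_ , _ , e) =
  trans (ℕₚ.*-distribʳ-+ c b d) (trans (cong (_+ d * c) e) (mediantʳ-ring a c d))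

Neighbors-<ˡ : ∀ {a b c d} → Neighbors a b c d → b < b + d
Neighbors-<ˡ {b = b} {d = d} (_ , (1≤d , _) , _) = subst (_≤ b + d) (ℕₚ.+-comm b 1) (ℕₚ.+-monoʳ-≤ b 1≤d)

Neighbors-<ʳ : ∀ {a b c d} → Neighbors a b c d → d < b + d
Neighbors-<ʳ ((1≤b , _) , _ , _) = ℕₚ.+-monoˡ-≤ _ 1≤b

half≡0 : ∀ c → 2 * c ≤ 1 → c ≡ 0
half≡0 zero    _       = refl
half≡0 (suc c) (s≤s h) with ℕₚ.m+n≤o⇒n≤o c h
... | ()

Neighbors⇒≢ : ∀ {a b c d} → Neighbors a b c d → b ≢ d
Neighbors⇒≢ {a} {b} {c} (_ , (_ , 2c≤b) , e) refl =
  ℕₚ.1+n≢0 (ℕₚ.m+n≡0⇒n≡0 (a * b) (trans (sym e) (trans (cong (b *_) c≡0) (ℕₚ.*-zeroʳ b))))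
  where
  b≡1 : b ≡ 1
  b≡1 = ∣1⇒≡1 (∣m+n∣m⇒∣n (subst (b ∣_) e (∣m⇒∣m*n c ∣-refl)) (n∣m*n a))
  c≡0 : c ≡ 0
  c≡0 = half≡0 c (subst (2 * c ≤_) b≡1 2c≤b)

Neighbors⇒3≤b+d : ∀ {a b c d} → Neighbors a b c d → 3 ≤ b + d
Neighbors⇒3≤b+d {a} {b} {c} {d} nb@((1≤b , _) , (1≤d , _) , _) with ℕₚ.<-cmp b d
... | tri< b<d _ _ = ℕₚ.+-mono-≤ 1≤b (ℕₚ.≤-trans (s≤s 1≤b) b<d)
... | tri≈ _ b≡d _ = ⊥-elim (Neighbors⇒≢ {a} {b} {c} {d} nb b≡d)
... | tri> _ _ d<b = ℕₚ.+-mono-≤ (ℕₚ.≤-trans (s≤s 1≤d) d<b) 1≤d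

¬Neighbors-0/1 : ∀ {a b} → ¬ Neighbors a b 0 1
¬Neighbors-0/1 {a} {b} (_ , _ , e) =
  ℕₚ.1+n≢0 (ℕₚ.m+n≡0⇒n≡0 (a * 1) (trans (sym e) (ℕₚ.*-zeroʳ b)))

¬Neighbors-1/2 : ∀ {c d} → ¬ Neighbors 1 2 c d
¬Neighbors-1/2 {c} {d} (_ , (_ , 2c≤d) , e) =
  ℕₚ.<-irrefl refl (ℕₚ.≤-trans (ℕₚ.≤-reflexive (suc-d d)) (subst (_≤ d) e 2c≤d))
  where
  suc-d : ∀ d → 1 + d ≡ 1 * d + 1
  suc-d = solve-∀

private
  mediant-den≰2 : ∀ {a b c d} → Neighbors a b c d → ¬ b + d ≤ 2
  mediant-den≰2 {a} {b} {c} {d} nb = ℕₚ.<⇒≱ (Neighbors⇒3≤b+d {a} {b} {c} {d} nb)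

MarkovWord-functional : ∀ {a b x a′ b′ x′} → MarkovWord a b x → MarkovWord a′ b′ x′ →
                        a ≡ a′ → b ≡ b′ → x ≡ x′
MarkovWord-functional w0 w0 _ _ = refl
MarkovWord-functional wh wh _ _ = refl
MarkovWord-functional w0 wh () _
MarkovWord-functional wh w0 () _
MarkovWord-functional w0 (wmed {a} {b} {c} {d} nb _ _) _ 1≡b+d =
  ⊥-elim (mediant-den≰2 {a} {b} {c} {d} nb (ℕₚ.≤-trans (ℕₚ.≤-reflexive (sym 1≡b+d)) (s≤s z≤n)))
MarkovWord-functional wh (wmed {a} {b} {c} {d} nb _ _) _ 2≡b+d =
  ⊥-elim (mediant-den≰2 {a} {b} {c} {d} nb (ℕₚ.≤-reflexive (sym 2≡b+d)))
MarkovWord-functional (wmed {a} {b} {c} {d} nb _ _) w0 _ b+d≡1 =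
  ⊥-elim (mediant-den≰2 {a} {b} {c} {d} nb (ℕₚ.≤-trans (ℕₚ.≤-reflexive b+d≡1) (s≤s z≤n)))
MarkovWord-functional (wmed {a} {b} {c} {d} nb _ _) wh _ b+d≡2 =
  ⊥-elim (mediant-den≰2 {a} {b} {c} {d} nb (ℕₚ.≤-reflexive b+d≡2))
MarkovWord-functional (wmed {a₁} {b₁} {c₁} {d₁} nb₁ X₁ Y₁) (wmed {a₂} {b₂} {c₂} {d₂} nb₂ X₂ Y₂) eC eD
  with left-neighbor-unique {a₁} {b₁} {a₂} {b₂} (Neighbors-mediantˡ nb₁)
         (subst₂ (λ C D → b₂ * C ≡ a₂ * D + 1) (sym eC) (sym eD) (Neighbors-mediantˡ nb₂))
         (Neighbors-<ˡ {a₁} {b₁} {c₁} {d₁} nb₁)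
         (subst (b₂ <_) (sym eD) (Neighbors-<ˡ {a₂} {b₂} {c₂} {d₂} nb₂))
... | refl , refl = cong₂ _++_
  (MarkovWord-functional Y₁ Y₂ (ℕₚ.+-cancelˡ-≡ a₁ c₁ c₂ eC) (ℕₚ.+-cancelˡ-≡ b₁ d₁ d₂ eD))
  (MarkovWord-functional X₁ X₂ refl refl)

record Swap (x y : List ℕ) : Set where
  field
    prefix suffix   : List ℕ
    prefix-even     : EvenLength prefix
    suffix-even     : EvenLength suffix
    prefix-positive : AllPositive prefix
    suffix-positive : AllPositive suffix
    xy≡ : x ++ y ≡ prefix ++ 1 ∷ 1 ∷ 2 ∷ 2 ∷ suffix
    yx≡ : y ++ x ≡ prefix ++ 2 ∷ 2 ∷ 1 ∷ 1 ∷ suffix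

Swap-base : Swap (1 ∷ 1 ∷ []) (2 ∷ 2 ∷ [])
Swap-base = record
  { prefix = [] ; suffix = [] ; prefix-even = [] ; suffix-even = []
  ; prefix-positive = [] ; suffix-positive = [] ; xy≡ = refl ; yx≡ = refl }

Swap-extendʳ : ∀ {x y} → IsPeriod x → Swap x y → Swap x (y ++ x)
Swap-extendʳ {x} {y} px sw = record
  { prefix = prefix ; suffix = suffix ++ x
  ; prefix-even = prefix-even ; suffix-even = EvenLength-++ suffix-even (IsPeriod.even px)
  ; prefix-positive = prefix-positive
  ; suffix-positive = AllPositive-++ suffix-positive (IsPeriod.positive px)
  ; xy≡ = trans (sym (++-assoc x y x)) (trans (cong (_++ x) xy≡) (++-assoc prefix _ x))
  ; yx≡ = trans (cong (_++ x) yx≡) (++-assoc prefix _ x)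
  }
  where open Swap sw

Swap-extendˡ : ∀ {x y} → IsPeriod y → Swap x y → Swap (y ++ x) y
Swap-extendˡ {x} {y} py sw = record
  { prefix = y ++ prefix ; suffix = suffix
  ; prefix-even = EvenLength-++ (IsPeriod.even py) prefix-even ; suffix-even = suffix-even
  ; prefix-positive = AllPositive-++ (IsPeriod.positive py) prefix-positive
  ; suffix-positive = suffix-positive
  ; xy≡ = trans (++-assoc y x y) (trans (cong (y ++_) xy≡) (sym (++-assoc y prefix _)))
  ; yx≡ = trans (cong (y ++_) yx≡) (sym (++-assoc y prefix _))
  }
  where open Swap sw

Swap-reverse : ∀ {x y} → Swap x y → Swap (reverse x) (reverse y)
Swap-reverse {x} {y} sw = record
  { prefix = reverse suffix ; suffix = reverse prefix
  ; prefix-even = EvenLength-reverse suffix-even ; suffix-even = EvenLength-reverse prefix-even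
  ; prefix-positive = AllPositive-reverse suffix-positive
  ; suffix-positive = AllPositive-reverse prefix-positive
  ; xy≡ = trans (sym (reverse-++ y x)) (reverse-block 2 2 1 1 yx≡)
  ; yx≡ = trans (sym (reverse-++ x y)) (reverse-block 1 1 2 2 xy≡)
  }
  where
  open Swap sw
  reverse-block : ∀ {l} (i j k m : ℕ) → l ≡ prefix ++ i ∷ j ∷ k ∷ m ∷ suffix →
                  reverse l ≡ reverse suffix ++ m ∷ k ∷ j ∷ i ∷ reverse prefix
  reverse-block i j k m refl = begin
    reverse (prefix ++ i ∷ j ∷ k ∷ m ∷ suffix)
      ≡⟨ reverse-++ prefix _ ⟩
    reverse (i ∷ j ∷ k ∷ m ∷ suffix) ++ reverse prefix
      ≡⟨ cong (_++ reverse prefix) (reverse-++ (i ∷ j ∷ k ∷ m ∷ []) suffix) ⟩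
    (reverse suffix ++ m ∷ k ∷ j ∷ i ∷ []) ++ reverse prefix
      ≡⟨ ++-assoc (reverse suffix) _ (reverse prefix) ⟩
    reverse suffix ++ m ∷ k ∷ j ∷ i ∷ reverse prefix ∎
    where open ≡-Reasoning

Swap⇒⊏ : ∀ {x y} → Swap x y → (x ++ y) ⊏ (y ++ x)
Swap⇒⊏ sw = subst₂ _⊏_ (sym xy≡) (sym yx≡)
  (⊏-prefix {prefix} prefix-even (∷-⊏ {1} {2} (s≤s (s≤s z≤n))
    (1≤1 ∷ 1≤2 ∷ 1≤2 ∷ suffix-positive) (1≤2 ∷ 1≤1 ∷ 1≤1 ∷ suffix-positive)))
  where
  open Swap sw
  1≤1 : 1 ≤ 1
  1≤1 = s≤s z≤n
  1≤2 : 1 ≤ 2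
  1≤2 = s≤s z≤n

-- The step of the induction where b < d: then a/b is the left parent of c/d, so w(a/b)
-- is the right factor of w(c/d).
left-step : ∀ {a b a′ b′ c′ d′ x y₁ y₂} → Neighbors a b (a′ + c′) (b′ + d′) → b < b′ + d′ →
            Neighbors a′ b′ c′ d′ → MarkovWord a b x → MarkovWord a′ b′ y₁ →
            (Neighbors a b c′ d′ → Swap x y₂) → Swap x (y₂ ++ y₁)
left-step {a} {b} {a′} {b′} {c′} {d′} nb b<D nb′ Dx Dy₁ ih
  with left-neighbor-unique {a} {b} {a′} {b′} {a′ + c′} {b′ + d′}
         (proj₂ (proj₂ nb)) (Neighbors-mediantˡ {a′} {b′} {c′} {d′} nb′)
         b<D (Neighbors-<ˡ {a′} {b′} {c′} {d′} nb′)
... | refl , refl with MarkovWord-functional Dx Dy₁ refl refl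
... | refl = Swap-extendʳ (MarkovWord⇒IsPeriod Dx) (ih nb′)

right-step : ∀ {a₁ b₁ c₁ d₁ c d x₁ x₂ y} → Neighbors (a₁ + c₁) (b₁ + d₁) c d → d < b₁ + d₁ →
             Neighbors a₁ b₁ c₁ d₁ → MarkovWord c d y → MarkovWord c₁ d₁ x₂ →
             (Neighbors a₁ b₁ c d → Swap x₁ y) → Swap (x₂ ++ x₁) y
right-step {a₁} {b₁} {c₁} {d₁} {c} {d} nb d<D nb₁ Dy Dx₂ ih
  with right-neighbor-unique {c} {d} {c₁} {d₁} {a₁ + c₁} {b₁ + d₁}
         (proj₂ (proj₂ nb)) (Neighbors-mediantʳ {a₁} {b₁} {c₁} {d₁} nb₁)
         d<D (Neighbors-<ʳ {a₁} {b₁} {c₁} {d₁} nb₁)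
... | refl , refl with MarkovWord-functional Dy Dx₂ refl refl
... | refl = Swap-extendˡ (MarkovWord⇒IsPeriod Dy) (ih nb₁)

private
  -- Case analysis without a with-clause, so that termination is checked on the derivations.
  tri-elim : ∀ {A B C R : Set} → Tri A B C → (A → R) → (B → R) → (C → R) → R
  tri-elim (tri< a _ _) f _ _ = f a
  tri-elim (tri≈ _ b _) _ g _ = g b
  tri-elim (tri> _ _ c) _ _ h = h c

neighbors-swap : ∀ {a b c d x y} → Neighbors a b c d → MarkovWord a b x → MarkovWord c d y → Swap x y
neighbors-swap nb w0 w0 = ⊥-elim (¬Neighbors-0/1 {0} {1} nb)
neighbors-swap nb w0 wh = Swap-base
neighbors-swap nb w0 (wmed {a′} {b′} {c′} {d′} nb′ Dy₁ Dy₂) =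
  left-step {c′ = c′} {d′} nb (ℕₚ.<-≤-trans (s≤s (s≤s z≤n)) (Neighbors⇒3≤b+d {a′} {b′} {c′} {d′} nb′))
    nb′ w0 Dy₁ (λ nb″ → neighbors-swap nb″ w0 Dy₂)
neighbors-swap {c = c} {d} nb wh Dy = ⊥-elim (¬Neighbors-1/2 {c} {d} nb)
neighbors-swap nb (wmed {a₁} {b₁} {c₁} {d₁} _ _ _) w0 = ⊥-elim (¬Neighbors-0/1 {a₁ + c₁} {b₁ + d₁} nb)
neighbors-swap nb (wmed {a₁} {b₁} {c₁} {d₁} nb₁ Dx₁ Dx₂) wh =
  right-step {a₁} {b₁} {c₁} {d₁} nb (Neighbors⇒3≤b+d {a₁} {b₁} {c₁} {d₁} nb₁)
    nb₁ wh Dx₂ (λ nb″ → neighbors-swap nb″ Dx₁ wh)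
neighbors-swap nb Dx@(wmed {a₁} {b₁} {c₁} {d₁} nb₁ Dx₁ Dx₂) Dy@(wmed {a₂} {b₂} {c₂} {d₂} nb₂ Dy₁ Dy₂) =
  tri-elim (ℕₚ.<-cmp (b₁ + d₁) (b₂ + d₂))
    (λ b<d → left-step {c′ = c₂} {d₂} nb b<d nb₂ Dx Dy₁ (λ nb″ → neighbors-swap nb″ Dx Dy₂))
    (λ b≡d → ⊥-elim (Neighbors⇒≢ {a₁ + c₁} {b₁ + d₁} {a₂ + c₂} {b₂ + d₂} nb b≡d))
    (λ d<b → right-step {a₁} {b₁} {c₁} {d₁} nb d<b nb₁ Dy Dx₂ (λ nb″ → neighbors-swap nb″ Dx₁ Dy))

neighbors-separated : ∀ {a b c d x y} → Neighbors a b c d → MarkovWord a b x → MarkovWord c d y →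
                       Separated x y × Separated (reverse x) (reverse y)
neighbors-separated nb Dx Dy =
  ++-swap-⊏⇒Separated (IsPeriod.even py) (IsPeriod.positive px) (IsPeriod.positive py) (Swap⇒⊏ sw) ,
  ++-swap-⊏⇒Separated (IsPeriod.even (IsPeriod-reverse py)) (IsPeriod.positive (IsPeriod-reverse px))
    (IsPeriod.positive (IsPeriod-reverse py)) (Swap⇒⊏ (Swap-reverse sw))
  where
  px = MarkovWord⇒IsPeriod Dx
  py = MarkovWord⇒IsPeriod Dy
  sw = neighbors-swap nb Dx Dy

-- The second alternative contradicts p < q, since Markov values increase with the parameter.
reverse-Separated : ∀ {p q a b c d} → IsPeriod p → IsPeriod q → Separated p q → Neighbors a b c d →
                    (IsMarkovWithParam p a b × IsMarkovWithParam q c d) ⊎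
                    (IsMarkovWithParam p c d × IsMarkovWithParam q a b) →
                    Separated (reverse p) (reverse q)
reverse-Separated {p} {q} pp pq p<q nb (inj₁ ((x , Dx , x≈p) , (y , Dy , y≈q))) =
  Separated-∼ (IsPeriod-reverse px) (IsPeriod-reverse py) (IsPeriod-reverse pp) (IsPeriod-reverse pq)
    (∼-reverse {x} {p} (≈ᴿ⇒∼ px pp x≈p)) (∼-reverse {y} {q} (≈ᴿ⇒∼ py pq y≈q))
    (proj₂ (neighbors-separated nb Dx Dy))
  where
  px = MarkovWord⇒IsPeriod Dx
  py = MarkovWord⇒IsPeriod Dy
reverse-Separated {p} {q} pp pq p<q nb (inj₂ ((y , Dy , y≈p) , (x , Dx , x≈q))) =
  ⊥-elim (Separated-asym {p} {q} p<q (Separated-∼ px py pq pp (≈ᴿ⇒∼ px pq x≈q) (≈ᴿ⇒∼ py pp y≈p)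
    (proj₁ (neighbors-separated nb Dx Dy))))
  where
  px = MarkovWord⇒IsPeriod Dx
  py = MarkovWord⇒IsPeriod Dy

lemma6p1 : (p q : List ℕ) → IsMinEvenPeriod p → IsMinEvenPeriod q →
           val p <ᴿ val q →
           ((k : ℕ) → 1 ≤ k → FourIneqs p q k) ×
           ((a b c d : ℕ) → Neighbors a b c d →
            ((IsMarkovWithParam p a b × IsMarkovWithParam q c d) ⊎
             (IsMarkovWithParam p c d × IsMarkovWithParam q a b)) →
            (val (reverse p) <ᴿ val (reverse q)) ×
            ((k : ℕ) → 1 ≤ k → FourIneqs (reverse p) (reverse q) k))
lemma6p1 p q min-p min-q u<v =
  fourInequalities pp pq p<q ,
  λ a b c d nb markov →
    let rp<rq = reverse-Separated pp pq p<q nb markov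
    in  Separated⇒<ᴿ rpp rpq rp<rq , fourInequalities rpp rpq rp<rq
  where
  pp  = IsMinEvenPeriod⇒IsPeriod min-p
  pq  = IsMinEvenPeriod⇒IsPeriod min-q
  rpp = IsPeriod-reverse pp
  rpq = IsPeriod-reverse pq
  p<q : Separated p q
  p<q = <ᴿ⇒Separated pp pq u<v
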